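{- Let $n$ be a positive integer and $p$ a prime with $p^r\,\|\,n$, $r\ge1$. Consider monic quadratic polynomials $f\in(\mathbb{Z}/p^r\mathbb{Z})[x]$ with discriminant $\Delta$ such that $\left(\frac{\Delta}{p}\right)=+1$ and such that: (a) $\Delta$ is a unit modulo $p^r$; (b) $0$ is not a root of $f$ modulo $p$; (c) $\mathrm{gcmd}(x^n-x,f(x))=f(x)$ modulo $p^r$. The number of such polynomials is exactly $$L_2^{++}(n,p)=\tfrac12\left(\gcd(n-1,p-1)^2-\gcd(n-1,p-1)\right).$$
   Context: $\left(\frac{\Delta}{p}\right)$ is the Legendre symbol of (any integer lift of) $\Delta$. For monic $g_1,g_2,h\in(\mathbb{Z}/p^r\mathbb{Z})[x]$, "$\mathrm{gcmd}(g_1,g_2)=h$ modulo $p^r$" means that the ideal generated by $g_1,g_2$ in $(\mathbb{Z}/p^r\mathbb{Z})[x]$ equals the ideal generated by $h$. -}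

module Defs where

open import Data.Nat as ℕ using (ℕ; zero; suc)
open import Data.Integer as ℤ using (ℤ; +_; _-_; -_)
open import Data.Integer.Divisibility as ℤD using ()
open import Data.List using (List; []; _∷_; map; replicate; _++_)
open import Data.Product using (Σ; _×_; ∃)
open import Relation.Nullary using (¬_)

_≡_[mod_] : ℤ → ℤ → ℕ → Set
a ≡ b [mod m ] = (+ m) ℤD.∣ (a - b)

-- Polynomials with integer coefficients, lowest degree first.
-- Elements of (ℤ/mℤ)[x] are represented by integer lifts, compared with _≡ₚ_[mod_].
Poly : Set
Poly = List ℤ

coeff : Poly → ℕ → ℤ
coeff []       _       = + 0
coeff (a ∷ _)  zero    = a
coeff (_ ∷ as) (suc i) = coeff as i

_+ₚ_ : Poly → Poly → Poly
[]       +ₚ q        = q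
(a ∷ as) +ₚ []       = a ∷ as
(a ∷ as) +ₚ (b ∷ bs) = (a ℤ.+ b) ∷ (as +ₚ bs)

-ₚ_ : Poly → Poly
-ₚ p = map -_ p

_-ₚ_ : Poly → Poly → Poly
p -ₚ q = p +ₚ (-ₚ q)

_*ₚ_ : Poly → Poly → Poly
[]       *ₚ q = []
(a ∷ as) *ₚ q = map (a ℤ.*_) q +ₚ (+ 0 ∷ (as *ₚ q))

eval : Poly → ℤ → ℤ
eval []       x = + 0
eval (a ∷ as) x = a ℤ.+ x ℤ.* eval as x

_≡ₚ_[mod_] : Poly → Poly → ℕ → Set
f ≡ₚ g [mod m ] = ∀ i → coeff f i ≡ coeff g i [mod m ]

Xpow : ℕ → Poly
Xpow n = replicate n (+ 0) ++ (+ 1 ∷ [])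

XnMinusX : ℕ → Poly
XnMinusX n = Xpow n -ₚ Xpow 1

-- gcmd(g₁,g₂) = h modulo m : the ideal (g₁,g₂) equals the ideal (h) in (ℤ/mℤ)[x]
GcmdIs : ℕ → Poly → Poly → Poly → Set
GcmdIs m g₁ g₂ h =
  (Σ Poly λ u → Σ Poly λ v → ((u *ₚ g₁) +ₚ (v *ₚ g₂)) ≡ₚ h [mod m ])
  × (Σ Poly λ w → g₁ ≡ₚ (w *ₚ h) [mod m ])
  × (Σ Poly λ w → g₂ ≡ₚ (w *ₚ h) [mod m ])

quad : ℤ → ℤ → Poly
quad b c = c ∷ b ∷ + 1 ∷ []

disc : ℤ → ℤ → ℤ
disc b c = b ℤ.* b - (+ 4) ℤ.* c

LegendreIsOne : ℤ → ℕ → Set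
LegendreIsOne Δ p = ¬ ((+ p) ℤD.∣ Δ) × ∃ λ (x : ℤ) → (x ℤ.* x) ≡ Δ [mod p ]

IsUnitMod : ℤ → ℕ → Set
IsUnitMod Δ m = ∃ λ (y : ℤ) → (Δ ℤ.* y) ≡ + 1 [mod m ]

L2pp : ℕ → ℕ → ℕ
L2pp n p = (g ℕ.* g ℕ.∸ g) ℕ./ 2
  where
  open import Data.Nat.GCD using (gcd)
  g = gcd (n ℕ.∸ 1) (p ℕ.∸ 1)

-- The conditions of Lemma 3.2 on the monic quadratic x² + b x + c over ℤ/p^r ℤ
-- (pr stands for the modulus p^r)
Conditions : (n p pr : ℕ) → ℤ → ℤ → Set
Conditions n p pr b c =
  LegendreIsOne (disc b c) p
  × IsUnitMod (disc b c) pr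
  × ¬ ((+ p) ℤD.∣ eval (quad b c) (+ 0))
  × GcmdIs pr (XnMinusX n) (quad b c) (quad b c)

-- Write N = n - 1, which is prime to p because p ∣ n, and q = p^r. The N-th roots of unity mod q form a
-- set R of g = gcd(N, p - 1) residues. Modulo p, by Bézout and Fermat they are the g-th roots of unity,
-- and x^g - 1 has exactly g roots: Lagrange's bound applies to it and to x (1 + x^g + ... + x^(p-1-g)),
-- whose roots together exhaust the p residues. Hensel's lemma, N x^(N-1) being a unit, makes reduction
-- mod p a bijection from the roots mod q onto the roots mod p.
-- A monic quadratic f whose discriminant is a nonzero square mod p (p odd) splits mod q as
-- (x - α)(x - β) with α - β a unit: complete the square and lift the square root. As 0 is not a root,
-- α and β are units, and gcmd(x^n - x, f) = f says that f divides x^n - x, i.e. that α, β ∈ R: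
-- evaluate at α and β for one direction, and exhibit the cofactor Σ h_k(α, β) x^(N-1-k) for the other.
-- So the polynomials are the (x - α)(x - β) for two-element subsets {α, β} of R: (g² - g)/2 of them.

module Submission where

module _ where
  open import Data.Empty using (⊥; ⊥-elim)
  open import Data.Fin using (Fin; toℕ; fromℕ<)
  import Data.Fin.Properties as Finₚ
  open import Data.Integer as ℤ using (ℤ; +_; -_; _+_; _*_; _-_; _^_; ∣_∣; _%ℕ_; _/ℕ_)
  import Data.Integer.Divisibility as ℤD
  open import Data.Integer.Divisibility.Signed as ℤ∣ using (divides; ∣ᵤ⇒∣; ∣⇒∣ᵤ) renaming (_∣_ to _∣ℤ_)
  import Data.Integer.DivMod as ℤ/
  import Data.Integer.Properties as ℤₚ
  open import Data.Integer.Tactic.RingSolver using (solve-∀)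
  open import Data.List using (List; []; _∷_; length; map; _++_; replicate; upTo; filter)
  open import Data.List.Membership.Propositional using (_∈_)
  open import Data.List.Membership.Propositional.Properties
    using (∈-filter⁺; ∈-filter⁻; ∈-upTo⁺; ∈-upTo⁻; ∈-map⁺; ∈-map⁻; ∈-++⁺ˡ; ∈-++⁺ʳ; ∈-++⁻)
  open import Data.List.Membership.Propositional.Properties.WithK using (unique∧set⇒bag)
  import Data.List.Properties as Listₚ
  open import Data.List.Relation.Binary.BagAndSetEquality using (_∼[_]_; set; ∼bag⇒↭)
  open import Data.List.Relation.Binary.Permutation.Propositional.Properties using (↭-length)
  open import Data.List.Relation.Unary.All as All using (All; []; _∷_)
  import Data.List.Relation.Unary.All.Properties as Allₚ
  open import Data.List.Relation.Unary.AllPairs using (AllPairs; []; _∷_)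
  open import Data.List.Relation.Unary.Any using (here; there)
  open import Data.List.Relation.Unary.Unique.Propositional using (Unique)
  import Data.List.Relation.Unary.Unique.Propositional.Properties as Uniqueₚ
  open import Data.Nat as ℕ using (ℕ; zero; suc; z≤n; s≤s; NonZero)
  open import Data.Nat.Combinatorics using (_C_; nC1≡n; nCn≡1; nCk+nC[k+1]≡[n+1]C[k+1])
  import Data.Nat.Divisibility as ℕ∣
  import Data.Nat.DivMod as ℕ%
  open import Data.Nat.GCD using (gcd; gcd-GCD; module Bézout; gcd[m,n]∣m; gcd[m,n]∣n)
  open import Data.Nat.Primality using (Prime; prime; euclidsLemma)
  import Data.Nat.Properties as ℕₚ
  open import Data.Nat.Tactic.RingSolver using () renaming (solve-∀ to ℕ-solve-∀)
  open import Data.Product as Product using (Σ; _×_; _,_; ∃; proj₁; proj₂)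
  open import Data.Sum as Sum using (_⊎_; inj₁; inj₂; [_,_]′)
  open import Function.Bundles using (_⇔_; mk⇔)
  open import Relation.Binary.PropositionalEquality
  open import Relation.Nullary using (¬_; yes; no)
  open import Relation.Unary using (Decidable; _≐_)
  open import Relation.Unary.Properties using (∁?)
  open import Defs

  infix 4 _≈[_]_
  record _≈[_]_ (a : ℤ) (m : ℕ) (b : ℤ) : Set where
    constructor mk≈
    field ∣diff : + m ∣ℤ a - b
  open _≈[_]_

  ∣0 : ∀ {k} → k ∣ℤ + 0
  ∣0 {k} = divides (+ 0) (sym (ℤₚ.*-zeroˡ k))

  module _ {m : ℕ} where

    ≈-reflexive : ∀ {a b} → a ≡ b → a ≈[ m ] b
    ≈-reflexive {a} refl = mk≈ (subst (_ ∣ℤ_) (sym (ℤₚ.+-inverseʳ a)) ∣0)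

    ≈-refl : ∀ {a} → a ≈[ m ] a
    ≈-refl = ≈-reflexive refl

    ≈-sym : ∀ {a b} → a ≈[ m ] b → b ≈[ m ] a
    ≈-sym {a} {b} (mk≈ d) = mk≈ (subst (_ ∣ℤ_) (flip a b) (ℤ∣.∣m⇒∣-m d))
      where
      flip : ∀ a b → - (a - b) ≡ b - a
      flip = solve-∀

    ≈-trans : ∀ {a b c} → a ≈[ m ] b → b ≈[ m ] c → a ≈[ m ] c
    ≈-trans {a} {b} {c} (mk≈ d) (mk≈ e) = mk≈ (subst (_ ∣ℤ_) (telescope a b c) (ℤ∣.∣m∣n⇒∣m+n d e))
      where
      telescope : ∀ a b c → (a - b) + (b - c) ≡ a - c
      telescope = solve-∀

    +-cong : ∀ {a b c d} → a ≈[ m ] b → c ≈[ m ] d → a + c ≈[ m ] b + d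
    +-cong {a} {b} {c} {d} (mk≈ x) (mk≈ y) = mk≈ (subst (_ ∣ℤ_) (regroup a b c d) (ℤ∣.∣m∣n⇒∣m+n x y))
      where
      regroup : ∀ a b c d → (a - b) + (c - d) ≡ (a + c) - (b + d)
      regroup = solve-∀

    -‿cong : ∀ {a b} → a ≈[ m ] b → - a ≈[ m ] - b
    -‿cong {a} {b} (mk≈ d) = mk≈ (subst (_ ∣ℤ_) (regroup a b) (ℤ∣.∣m⇒∣-m d))
      where
      regroup : ∀ a b → - (a - b) ≡ (- a) - (- b)
      regroup = solve-∀

    -cong : ∀ {a b c d} → a ≈[ m ] b → c ≈[ m ] d → a - c ≈[ m ] b - d
    -cong x y = +-cong x (-‿cong y)

    *-cong : ∀ {a b c d} → a ≈[ m ] b → c ≈[ m ] d → a * c ≈[ m ] b * d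
    *-cong {a} {b} {c} {d} (mk≈ x) (mk≈ y) =
      mk≈ (subst (_ ∣ℤ_) (regroup a b c d) (ℤ∣.∣m∣n⇒∣m+n (ℤ∣.∣n⇒∣m*n a y) (ℤ∣.∣m⇒∣m*n d x)))
      where
      regroup : ∀ a b c d → a * (c - d) + (a - b) * d ≡ a * c - b * d
      regroup = solve-∀

    *-congˡ : ∀ {a b} c → a ≈[ m ] b → c * a ≈[ m ] c * b
    *-congˡ c = *-cong (≈-refl {c})

    ^-cong : ∀ {a b} k → a ≈[ m ] b → a ^ k ≈[ m ] b ^ k
    ^-cong zero    a≈b = ≈-refl
    ^-cong (suc k) a≈b = *-cong a≈b (^-cong k a≈b)

    ≈0⇒∣ : ∀ {a} → a ≈[ m ] + 0 → + m ∣ℤ a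
    ≈0⇒∣ {a} (mk≈ m∣a) = subst (_ ∣ℤ_) (ℤₚ.+-identityʳ a) m∣a

    ∣-resp-≈ : ∀ {a b} → a ≈[ m ] b → + m ∣ℤ a → + m ∣ℤ b
    ∣-resp-≈ {a} {b} (mk≈ d) m∣a = subst (_ ∣ℤ_) (cancel a b) (ℤ∣.∣m∣n⇒∣m-n m∣a d)
      where
      cancel : ∀ a b → a - (a - b) ≡ b
      cancel = solve-∀

  ≈-weaken : ∀ {m m′ a b} → m ℕ∣.∣ m′ → a ≈[ m′ ] b → a ≈[ m ] b
  ≈-weaken m∣m′ (mk≈ d) = mk≈ (ℤ∣.∣-trans (∣ᵤ⇒∣ m∣m′) d)

  ≈⇒≡[mod] : ∀ {m a b} → a ≈[ m ] b → a ≡ b [mod m ]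
  ≈⇒≡[mod] (mk≈ d) = ∣⇒∣ᵤ d

  ≡[mod]⇒≈ : ∀ {m a b} → a ≡ b [mod m ] → a ≈[ m ] b
  ≡[mod]⇒≈ d = mk≈ (∣ᵤ⇒∣ d)

  module ≈-Reasoning (m : ℕ) where
    infix  1 begin_
    infixr 2 _≈⟨_⟩_ _≡⟨_⟩_
    infix 3 _∎
    begin_ : ∀ {a b} → a ≈[ m ] b → a ≈[ m ] b
    begin a≈b = a≈b
    _≈⟨_⟩_ : ∀ a {b c} → a ≈[ m ] b → b ≈[ m ] c → a ≈[ m ] c
    a ≈⟨ a≈b ⟩ b≈c = ≈-trans a≈b b≈c
    _≡⟨_⟩_ : ∀ a {b c} → a ≡ b → b ≈[ m ] c → a ≈[ m ] c
    a ≡⟨ refl ⟩ b≈c = b≈c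
    _∎ : ∀ a → a ≈[ m ] a
    a ∎ = ≈-refl

  %ℕ-≈ : ∀ z m .{{_ : NonZero m}} → + (z %ℕ m) ≈[ m ] z
  %ℕ-≈ z m = mk≈ (divides (- (z /ℕ m)) (remainder (z %ℕ m) (z /ℕ m) (ℤ/.a≡a%ℕn+[a/ℕn]*n z m)))
    where
    remainder : ∀ r q → z ≡ + r + q * + m → + r - z ≡ - q * + m
    remainder r q refl = lemma (+ r) q (+ m)
      where
      lemma : ∀ r q m → r - (r + q * m) ≡ - q * m
      lemma = solve-∀

  ∣∧<⇒≡0 : ∀ {m k} → m ℕ∣.∣ k → k ℕ.< m → k ≡ 0
  ∣∧<⇒≡0 {k = zero}  _   _   = refl
  ∣∧<⇒≡0 {k = suc k} m∣k k<m = ⊥-elim (ℕ∣.>⇒∤ k<m m∣k)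

  <∧≈⇒≡ : ∀ {m x y} → x ℕ.< m → y ℕ.< m → + x ≈[ m ] + y → x ≡ y
  <∧≈⇒≡ {m} {x} {y} x<m y<m (mk≈ m∣x-y) =
    ℤₚ.+-injective (ℤₚ.i-j≡0⇒i≡j (+ x) (+ y) (ℤₚ.∣i∣≡0⇒i≡0 (∣∧<⇒≡0 (∣⇒∣ᵤ m∣x-y) ∣x-y∣<m)))
    where
    ∣x-y∣<m : ∣ + x - + y ∣ ℕ.< m
    ∣x-y∣<m = ℕₚ.≤-<-trans (ℕₚ.≤-reflexive (cong ∣_∣ (ℤₚ.[+m]-[+n]≡m⊖n x y)))
                (ℕₚ.≤-<-trans (ℤₚ.∣m⊝n∣≤m⊔n x y) (ℕₚ.⊔-lub x<m y<m))

  module _ (m : ℕ) .{{_ : NonZero m}} where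

    residue : ℤ → Fin m
    residue z = fromℕ< (ℤ/.n%ℕd<d z m)

    toℕ-residue : ∀ z → + toℕ (residue z) ≈[ m ] z
    toℕ-residue z = subst (λ k → + k ≈[ m ] z) (sym (Finₚ.toℕ-fromℕ< _)) (%ℕ-≈ z m)

    residue-cong : ∀ {z w} → z ≈[ m ] w → residue z ≡ residue w
    residue-cong {z} {w} z≈w = Finₚ.toℕ-injective (<∧≈⇒≡ (Finₚ.toℕ<n (residue z)) (Finₚ.toℕ<n (residue w))
      (≈-trans (toℕ-residue z) (≈-trans z≈w (≈-sym (toℕ-residue w)))))

    residue-injective : ∀ {z w} → residue z ≡ residue w → z ≈[ m ] w
    residue-injective {z} {w} eq = ≈-trans (≈-sym (toℕ-residue z)) (subst (λ i → + toℕ i ≈[ m ] w) (sym eq) (toℕ-residue w))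

    residue-toℕ : ∀ i → residue (+ toℕ i) ≡ i
    residue-toℕ i = Finₚ.toℕ-injective (<∧≈⇒≡ (Finₚ.toℕ<n _) (Finₚ.toℕ<n i) (toℕ-residue (+ toℕ i)))

  +-cancelˡ-≈ : ∀ {m} x {y z} → x + y ≈[ m ] x + z → y ≈[ m ] z
  +-cancelˡ-≈ x {y} {z} x+y≈x+z =
    ≈-trans (≈-reflexive (cancel x y)) (≈-trans (-cong x+y≈x+z (≈-refl {a = x})) (≈-reflexive (sym (cancel x z))))
    where
    cancel : ∀ x y → y ≡ x + y - x
    cancel = solve-∀

  ^-≈1-multiple : ∀ {m z} a x → z ^ a ≈[ m ] + 1 → z ^ (a ℕ.* x) ≈[ m ] + 1
  ^-≈1-multiple {z = z} a x z^a≈1 =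
    ≈-trans (≈-reflexive (sym (ℤₚ.^-*-assoc z a x))) (≈-trans (^-cong x z^a≈1) (≈-reflexive (ℤₚ.^-zeroˡ x)))

  ^-≈1-cancel : ∀ {m z} g v → z ^ v ≈[ m ] + 1 → z ^ (g ℕ.+ v) ≈[ m ] + 1 → z ^ g ≈[ m ] + 1
  ^-≈1-cancel {m} {z} g v z^v≈1 z^g+v≈1 = begin
      z ^ g              ≡⟨ sym (ℤₚ.*-identityʳ (z ^ g)) ⟩
      z ^ g * + 1        ≈⟨ *-congˡ (z ^ g) (≈-sym z^v≈1) ⟩
      z ^ g * z ^ v      ≡⟨ sym (ℤₚ.^-distribˡ-+-* z g v) ⟩
      z ^ (g ℕ.+ v)      ≈⟨ z^g+v≈1 ⟩
      + 1                ∎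
    where open ≈-Reasoning m

  ∣-square : ∀ {p q} e → p ℕ∣.∣ q → + q ∣ℤ e → + (p ℕ.* q) ∣ℤ e * e
  ∣-square {p} {q} e (ℕ∣.divides s q≡sp) (divides t refl) = divides (t * t * + s) (begin
      t * + q * (t * + q)        ≡⟨ regroup t (+ q) ⟩
      t * t * + q * + q          ≡⟨ cong (λ x → t * t * x * + q) (trans (cong +_ q≡sp) (ℤₚ.pos-* s p)) ⟩
      t * t * (+ s * + p) * + q  ≡⟨ regroup′ t (+ s) (+ p) (+ q) ⟩
      t * t * + s * (+ p * + q)  ≡⟨ cong (t * t * + s *_) (sym (ℤₚ.pos-* p q)) ⟩
      t * t * + s * + (p ℕ.* q)  ∎)
    where
    open ≡-Reasoning
    regroup : ∀ t q → t * q * (t * q) ≡ t * t * q * q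
    regroup = solve-∀
    regroup′ : ∀ t s p q → t * t * (s * p) * q ≡ t * t * s * (p * q)
    regroup′ = solve-∀

  -- Finite sums and the binomial theorem

  ∑ : ℕ → (ℕ → ℤ) → ℤ
  ∑ zero    f = + 0
  ∑ (suc n) f = f 0 + ∑ n (λ k → f (suc k))

  ∑-cong : ∀ n {f g} → (∀ k → f k ≡ g k) → ∑ n f ≡ ∑ n g
  ∑-cong zero    f≗g = refl
  ∑-cong (suc n) f≗g = cong₂ _+_ (f≗g 0) (∑-cong n (λ k → f≗g (suc k)))

  ∑-+ : ∀ n f g → ∑ n (λ k → f k + g k) ≡ ∑ n f + ∑ n g
  ∑-+ zero    f g = refl
  ∑-+ (suc n) f g = trans (cong (_+_ (f 0 + g 0)) (∑-+ n _ _)) (swap (f 0) (g 0) _ _)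
    where
    swap : ∀ a b c d → a + b + (c + d) ≡ a + c + (b + d)
    swap = solve-∀

  ∑-*ˡ : ∀ n c f → ∑ n (λ k → c * f k) ≡ c * ∑ n f
  ∑-*ˡ zero    c f = sym (ℤₚ.*-zeroʳ c)
  ∑-*ˡ (suc n) c f = trans (cong (_+_ (c * f 0)) (∑-*ˡ n c _)) (sym (ℤₚ.*-distribˡ-+ c (f 0) _))

  ∑-0 : ∀ n → ∑ n (λ _ → + 0) ≡ + 0
  ∑-0 zero    = refl
  ∑-0 (suc n) = trans (ℤₚ.+-identityˡ _) (∑-0 n)

  ∑-last : ∀ n f → ∑ (suc n) f ≡ ∑ n f + f n
  ∑-last zero    f = ℤₚ.+-comm (f 0) (+ 0)
  ∑-last (suc n) f = trans (cong (_+_ (f 0)) (∑-last n _)) (sym (ℤₚ.+-assoc (f 0) _ _))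

  ∑-∣ : ∀ {d} n f → (∀ k → k ℕ.< n → d ∣ℤ f k) → d ∣ℤ ∑ n f
  ∑-∣ zero    f d∣f = ∣0
  ∑-∣ (suc n) f d∣f = ℤ∣.∣m∣n⇒∣m+n (d∣f 0 (s≤s z≤n)) (∑-∣ n _ (λ k k<n → d∣f (suc k) (s≤s k<n)))

  C-absorption : ∀ n k → suc k ℕ.* (suc n C suc k) ≡ suc n ℕ.* (n C k)
  C-absorption zero    zero    = refl
  C-absorption zero    (suc k) = ℕₚ.*-zeroʳ (suc (suc k))
  C-absorption (suc n) zero    = trans (ℕₚ.*-identityˡ _) (trans (nC1≡n (suc (suc n))) (sym (ℕₚ.*-identityʳ _)))
  C-absorption (suc n) (suc k) = begin
      suc (suc k) ℕ.* (suc (suc n) C suc (suc k))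
    ≡⟨ cong (suc (suc k) ℕ.*_) (sym (nCk+nC[k+1]≡[n+1]C[k+1] (suc n) (suc k))) ⟩
      suc (suc k) ℕ.* (A ℕ.+ B)
    ≡⟨ regroup k A B ⟩
      suc k ℕ.* A ℕ.+ A ℕ.+ suc (suc k) ℕ.* B
    ≡⟨ cong₂ (λ x y → x ℕ.+ A ℕ.+ y) (C-absorption n k) (C-absorption n (suc k)) ⟩
      suc n ℕ.* (n C k) ℕ.+ A ℕ.+ suc n ℕ.* (n C suc k)
    ≡⟨ regroup′ n (n C k) (n C suc k) A ⟩
      suc n ℕ.* (n C k ℕ.+ n C suc k) ℕ.+ A
    ≡⟨ cong (λ x → suc n ℕ.* x ℕ.+ A) (nCk+nC[k+1]≡[n+1]C[k+1] n k) ⟩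
      suc n ℕ.* A ℕ.+ A
    ≡⟨ ℕₚ.+-comm (suc n ℕ.* A) A ⟩
      suc (suc n) ℕ.* A ∎
    where
    open ≡-Reasoning
    A = suc n C suc k
    B = suc n C suc (suc k)
    regroup : ∀ k a b → suc (suc k) ℕ.* (a ℕ.+ b) ≡ suc k ℕ.* a ℕ.+ a ℕ.+ suc (suc k) ℕ.* b
    regroup = ℕ-solve-∀
    regroup′ : ∀ n x y a → suc n ℕ.* x ℕ.+ a ℕ.+ suc n ℕ.* y ≡ suc n ℕ.* (x ℕ.+ y) ℕ.+ a
    regroup′ = ℕ-solve-∀

  binomial-theorem : ∀ x n M → n ℕ.< M → (+ 1 + x) ^ n ≡ ∑ M (λ k → + (n C k) * x ^ k)
  binomial-theorem x zero    (suc M) _ =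
    sym (cong (_+_ (+ 1)) (trans (∑-cong M (λ k → ℤₚ.*-zeroˡ (x ^ suc k))) (∑-0 M)))
  binomial-theorem x (suc n) (suc M) (s≤s n<M) = begin
      (+ 1 + x) * (+ 1 + x) ^ n
    ≡⟨ cong ((+ 1 + x) *_) (expand (suc M) (ℕₚ.m<n⇒m<1+n n<M)) ⟩
      (+ 1 + x) * (+ 1 * + 1 + S₂)
    ≡⟨ regroup x S₂ ⟩
      + 1 * + 1 + (x * (+ 1 * + 1 + S₂) + S₂)
    ≡⟨ cong (λ s → + 1 * + 1 + (x * s + S₂)) (trans (sym (expand (suc M) (ℕₚ.m<n⇒m<1+n n<M))) (expand M n<M)) ⟩
      + 1 * + 1 + (x * ∑ M (λ k → + (n C k) * x ^ k) + S₂)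
    ≡⟨ cong (λ s → + 1 * + 1 + (s + S₂)) (sym (∑-*ˡ M x _)) ⟩
      + 1 * + 1 + (∑ M (λ k → x * (+ (n C k) * x ^ k)) + S₂)
    ≡⟨ cong (_+_ (+ 1 * + 1)) (sym (∑-+ M _ _)) ⟩
      + 1 * + 1 + ∑ M (λ k → x * (+ (n C k) * x ^ k) + + (n C suc k) * x ^ suc k)
    ≡⟨ cong (_+_ (+ 1 * + 1)) (∑-cong M pascal) ⟩
      ∑ (suc M) (λ k → + (suc n C k) * x ^ k) ∎
    where
    open ≡-Reasoning
    expand : ∀ M → n ℕ.< M → (+ 1 + x) ^ n ≡ ∑ M (λ k → + (n C k) * x ^ k)
    expand = binomial-theorem x n
    S₂ = ∑ M (λ k → + (n C suc k) * x ^ suc k)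
    regroup : ∀ x s → (+ 1 + x) * (+ 1 * + 1 + s) ≡ + 1 * + 1 + (x * (+ 1 * + 1 + s) + s)
    regroup = solve-∀
    collect : ∀ x a b y → x * (a * y) + b * (x * y) ≡ (a + b) * (x * y)
    collect = solve-∀
    pascal : ∀ k → x * (+ (n C k) * x ^ k) + + (n C suc k) * x ^ suc k ≡ + (suc n C suc k) * x ^ suc k
    pascal k = trans (collect x (+ (n C k)) (+ (n C suc k)) (x ^ k))
                     (cong (λ c → + c * x ^ suc k) (nCk+nC[k+1]≡[n+1]C[k+1] n k))

  ^-taylor : ∀ a e n → ∃ λ R → (a + e) ^ suc n ≡ a ^ suc n + + suc n * a ^ n * e + e * e * R
  ^-taylor a e zero    = + 0 , expand a e
    where
    expand : ∀ a e → (a + e) * + 1 ≡ a * + 1 + + 1 * + 1 * e + e * e * + 0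
    expand = solve-∀
  ^-taylor a e (suc n) with ^-taylor a e n
  ... | R , eq = a * R + + suc n * a ^ n + e * R , trans (cong ((a + e) *_) eq) (expand a e R (a ^ n) (+ suc n))
    where
    expand : ∀ a e R x k → (a + e) * (a * x + k * x * e + e * e * R)
                          ≡ a * (a * x) + (+ 1 + k) * (a * x) * e + e * e * (a * R + k * x + e * R)
    expand = solve-∀

  module _ {A : Set} {P : A → Set} (P? : Decidable P) where

    length-filter+length-filter-∁ : ∀ xs → length (filter P? xs) ℕ.+ length (filter (∁? P?) xs) ≡ length xs
    length-filter+length-filter-∁ []       = refl
    length-filter+length-filter-∁ (x ∷ xs) with P? x
    ... | yes _ = cong suc (length-filter+length-filter-∁ xs)
    ... | no  _ = trans (ℕₚ.+-suc _ _) (cong suc (length-filter+length-filter-∁ xs))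

  map-injectiveOn⁺ : ∀ {A B : Set} (f : A → B) {xs} → (∀ {x y} → x ∈ xs → y ∈ xs → f x ≡ f y → x ≡ y)
                   → Unique xs → Unique (map f xs)
  map-injectiveOn⁺ f {[]}     _   []            = []
  map-injectiveOn⁺ f {x ∷ xs} inj (x∉xs ∷ xs!) =
    Allₚ.map⁺ (All.tabulate (λ y∈xs fx≡fy → All.lookup x∉xs y∈xs (inj (here refl) (there y∈xs) fx≡fy)))
    ∷ map-injectiveOn⁺ f (λ x∈ y∈ → inj (there x∈) (there y∈)) xs!

  module _ {X : Set} where

    pairs : List X → List (X × X)
    pairs []       = []
    pairs (x ∷ xs) = map (x ,_) xs ++ pairs xs

    length-pairs : ∀ xs → 2 ℕ.* length (pairs xs) ℕ.+ length xs ≡ length xs ℕ.* length xs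
    length-pairs []       = refl
    length-pairs (x ∷ xs) = begin
        2 ℕ.* length (map (x ,_) xs ++ pairs xs) ℕ.+ suc n
      ≡⟨ cong (λ l → 2 ℕ.* l ℕ.+ suc n) (trans (Listₚ.length-++ (map (x ,_) xs)) (cong (ℕ._+ P) (Listₚ.length-map _ xs))) ⟩
        2 ℕ.* (n ℕ.+ P) ℕ.+ suc n
      ≡⟨ regroup n P ⟩
        suc (n ℕ.+ n) ℕ.+ (2 ℕ.* P ℕ.+ n)
      ≡⟨ cong (suc (n ℕ.+ n) ℕ.+_) (length-pairs xs) ⟩
        suc (n ℕ.+ n) ℕ.+ n ℕ.* n
      ≡⟨ square n ⟩
        suc n ℕ.* suc n ∎
      where
      open ≡-Reasoning
      n = length xs
      P = length (pairs xs)
      regroup : ∀ n P → 2 ℕ.* (n ℕ.+ P) ℕ.+ suc n ≡ suc (n ℕ.+ n) ℕ.+ (2 ℕ.* P ℕ.+ n)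
      regroup = ℕ-solve-∀
      square : ∀ n → suc (n ℕ.+ n) ℕ.+ n ℕ.* n ≡ suc n ℕ.* suc n
      square = ℕ-solve-∀

    ∈-pairs⁻ : ∀ {a b} xs → (a , b) ∈ pairs xs → a ∈ xs × b ∈ xs
    ∈-pairs⁻ (x ∷ xs) ab∈ with ∈-++⁻ (map (x ,_) xs) ab∈
    ... | inj₁ ab∈head with ∈-map⁻ (x ,_) ab∈head
    ...   | y , y∈xs , refl = here refl , there y∈xs
    ∈-pairs⁻ (x ∷ xs) ab∈ | inj₂ ab∈tail = Product.map there there (∈-pairs⁻ xs ab∈tail)

    ∈-pairs⁺ : ∀ {a b} xs → a ∈ xs → b ∈ xs → a ≢ b → (a , b) ∈ pairs xs ⊎ (b , a) ∈ pairs xs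
    ∈-pairs⁺ (x ∷ xs) (here refl) (here refl) a≢b = ⊥-elim (a≢b refl)
    ∈-pairs⁺ (x ∷ xs) (here refl) (there b∈) _   = inj₁ (∈-++⁺ˡ (∈-map⁺ (x ,_) b∈))
    ∈-pairs⁺ (x ∷ xs) (there a∈) (here refl) _   = inj₂ (∈-++⁺ˡ (∈-map⁺ (x ,_) a∈))
    ∈-pairs⁺ (x ∷ xs) (there a∈) (there b∈) a≢b = Sum.map (∈-++⁺ʳ _) (∈-++⁺ʳ _) (∈-pairs⁺ xs a∈ b∈ a≢b)

    ∈-pairs⇒≢ : ∀ {a b} xs → Unique xs → (a , b) ∈ pairs xs → a ≢ b
    ∈-pairs⇒≢ (x ∷ xs) (x∉xs ∷ xs!) ab∈ with ∈-++⁻ (map (x ,_) xs) ab∈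
    ... | inj₁ ab∈head with ∈-map⁻ (x ,_) ab∈head
    ...   | y , y∈xs , refl = All.lookup x∉xs y∈xs
    ∈-pairs⇒≢ (x ∷ xs) (_ ∷ xs!) ab∈ | inj₂ ab∈tail = ∈-pairs⇒≢ xs xs! ab∈tail

    ∈-pairs-asym : ∀ {a b} xs → Unique xs → (a , b) ∈ pairs xs → (b , a) ∈ pairs xs → ⊥
    ∈-pairs-asym (x ∷ xs) (x∉xs ∷ xs!) ab∈ ba∈ with ∈-++⁻ (map (x ,_) xs) ab∈ | ∈-++⁻ (map (x ,_) xs) ba∈
    ... | inj₁ ab∈head | inj₁ ba∈head with ∈-map⁻ (x ,_) ab∈head | ∈-map⁻ (x ,_) ba∈head
    ...   | y , y∈xs , refl | _ , _ , refl = All.lookup x∉xs y∈xs refl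
    ∈-pairs-asym (x ∷ xs) (x∉xs ∷ _) _ _ | inj₁ ab∈head | inj₂ ba∈tail with ∈-map⁻ (x ,_) ab∈head
    ...   | y , _ , refl = All.lookup x∉xs (proj₂ (∈-pairs⁻ xs ba∈tail)) refl
    ∈-pairs-asym (x ∷ xs) (x∉xs ∷ _) _ _ | inj₂ ab∈tail | inj₁ ba∈head with ∈-map⁻ (x ,_) ba∈head
    ...   | y , _ , refl = All.lookup x∉xs (proj₂ (∈-pairs⁻ xs ab∈tail)) refl
    ∈-pairs-asym (x ∷ xs) (_ ∷ xs!) _ _ | inj₂ ab∈tail | inj₂ ba∈tail = ∈-pairs-asym xs xs! ab∈tail ba∈tail

    pairs-unique : ∀ xs → Unique xs → Unique (pairs xs)
    pairs-unique []       _             = []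
    pairs-unique (x ∷ xs) (x∉xs ∷ xs!) =
      Uniqueₚ.++⁺ (map-injectiveOn⁺ (x ,_) (λ _ _ → cong proj₂) xs!) (pairs-unique xs xs!) disjoint
      where
      disjoint : ∀ {v} → ¬ (v ∈ map (x ,_) xs × v ∈ pairs xs)
      disjoint (v∈head , v∈tail) with ∈-map⁻ (x ,_) v∈head
      ... | y , _ , refl = All.lookup x∉xs (proj₁ (∈-pairs⁻ xs v∈tail)) refl

  length-pairs≡half : ∀ {X : Set} (xs : List X) → length (pairs xs) ≡ (length xs ℕ.* length xs ℕ.∸ length xs) ℕ./ 2
  length-pairs≡half xs = sym (begin
      (n ℕ.* n ℕ.∸ n) ℕ./ 2          ≡⟨ cong (λ k → (k ℕ.∸ n) ℕ./ 2) (sym (length-pairs xs)) ⟩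
      (2 ℕ.* P ℕ.+ n ℕ.∸ n) ℕ./ 2    ≡⟨ cong (ℕ._/ 2) (ℕₚ.m+n∸n≡m (2 ℕ.* P) n) ⟩
      (2 ℕ.* P) ℕ./ 2                ≡⟨ cong (ℕ._/ 2) (ℕₚ.*-comm 2 P) ⟩
      (P ℕ.* 2) ℕ./ 2                ≡⟨ ℕ%.m*n/n≡m P 2 ⟩
      P                              ∎)
    where
    open ≡-Reasoning
    n = length xs
    P = length (pairs xs)

  residues-incongruent : ∀ {m} xs → Unique xs → All (ℕ._< m) xs → AllPairs (λ u v → ¬ (+ m ∣ℤ u - v)) (map +_ xs)
  residues-incongruent []       _             _              = []
  residues-incongruent (x ∷ xs) (x∉xs ∷ xs!) (x<m ∷ xs<m) =
    Allₚ.map⁺ (All.zipWith incongruent (x∉xs , xs<m)) ∷ residues-incongruent xs xs! xs<m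
    where
    incongruent : ∀ {y} → x ≢ y × y ℕ.< _ → ¬ (+ _ ∣ℤ + x - + y)
    incongruent (x≢y , y<m) m∣x-y = x≢y (<∧≈⇒≡ x<m y<m (mk≈ m∣x-y))

  monic : List ℤ → Poly
  monic cs = cs ++ + 1 ∷ []

  eval-+ₚ : ∀ f g x → eval (f +ₚ g) x ≡ eval f x + eval g x
  eval-+ₚ []       g        x = sym (ℤₚ.+-identityˡ _)
  eval-+ₚ (a ∷ f)  []       x = sym (ℤₚ.+-identityʳ _)
  eval-+ₚ (a ∷ f)  (b ∷ g)  x = trans (cong (λ v → a + b + x * v) (eval-+ₚ f g x)) (regroup a b x (eval f x) (eval g x))
    where
    regroup : ∀ a b x u v → a + b + x * (u + v) ≡ a + x * u + (b + x * v)
    regroup = solve-∀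

  eval-map-* : ∀ c f x → eval (map (c *_) f) x ≡ c * eval f x
  eval-map-* c []      x = sym (ℤₚ.*-zeroʳ c)
  eval-map-* c (a ∷ f) x = trans (cong (λ v → c * a + x * v) (eval-map-* c f x)) (regroup c a x (eval f x))
    where
    regroup : ∀ c a x u → c * a + x * (c * u) ≡ c * (a + x * u)
    regroup = solve-∀

  eval-monic-[] : ∀ x → eval (monic []) x ≡ + 1
  eval-monic-[] x = cong (_+_ (+ 1)) (ℤₚ.*-zeroʳ x)

  quotient : Poly → ℤ → Poly
  quotient []      a = []
  quotient (c ∷ f) a = f +ₚ map (a *_) (quotient f a)

  eval-quotient : ∀ f a x → eval f x - eval f a ≡ (x - a) * eval (quotient f a) x
  eval-quotient []      a x = sym (ℤₚ.*-zeroʳ (x - a))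
  eval-quotient (c ∷ f) a x = begin
      c + x * eval f x - (c + a * eval f a)
    ≡⟨ regroup c x a (eval f x) (eval f a) ⟩
      (x - a) * eval f x + a * (eval f x - eval f a)
    ≡⟨ cong (λ v → (x - a) * eval f x + a * v) (eval-quotient f a x) ⟩
      (x - a) * eval f x + a * ((x - a) * eval (quotient f a) x)
    ≡⟨ regroup′ x a (eval f x) (eval (quotient f a) x) ⟩
      (x - a) * (eval f x + a * eval (quotient f a) x)
    ≡⟨ cong ((x - a) *_) (sym (trans (eval-+ₚ f _ x) (cong (_+_ (eval f x)) (eval-map-* a (quotient f a) x)))) ⟩
      (x - a) * eval (quotient (c ∷ f) a) x ∎
    where
    open ≡-Reasoning
    regroup : ∀ c x a u v → c + x * u - (c + a * v) ≡ (x - a) * u + a * (u - v)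
    regroup = solve-∀
    regroup′ : ∀ x a u s → (x - a) * u + a * ((x - a) * s) ≡ (x - a) * (u + a * s)
    regroup′ = solve-∀

  +ₚ-monic : ∀ cs ds → length ds ≡ length cs → monic cs +ₚ ds ≡ monic (cs +ₚ ds) × length (cs +ₚ ds) ≡ length cs
  +ₚ-monic []       []       _   = refl , refl
  +ₚ-monic (c ∷ cs) (d ∷ ds) len with +ₚ-monic cs ds (ℕₚ.suc-injective len)
  ... | eq , len′ = cong ((c + d) ∷_) eq , cong suc len′

  quotient-monic : ∀ c cs a → ∃ λ cs′ → quotient (monic (c ∷ cs)) a ≡ monic cs′ × length cs′ ≡ length cs
  quotient-monic c []       a = [] , refl , refl
  quotient-monic c (d ∷ cs) a with quotient-monic d cs a
  ... | cs′ , eq , len = (d ∷ cs) +ₚ ds ,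
      trans (cong (λ f → monic (d ∷ cs) +ₚ map (a *_) f) eq)
            (trans (cong (monic (d ∷ cs) +ₚ_) (Listₚ.map-++ (a *_) cs′ (+ 1 ∷ []))) (proj₁ sum)) ,
      proj₂ sum
    where
    ds = map (a *_) cs′ ++ a * + 1 ∷ []
    len-ds : length ds ≡ length (d ∷ cs)
    len-ds = trans (Listₚ.length-++ (map (a *_) cs′)) (trans (cong (ℕ._+ 1) (trans (Listₚ.length-map _ cs′) len))
                                                             (ℕₚ.+-comm (length cs) 1))
    sum = +ₚ-monic (d ∷ cs) ds len-ds

  eval-replicate-0 : ∀ j f x → eval (replicate j (+ 0) ++ f) x ≡ x ^ j * eval f x
  eval-replicate-0 zero    f x = sym (ℤₚ.*-identityˡ _)
  eval-replicate-0 (suc j) f x = trans (cong (λ v → + 0 + x * v) (eval-replicate-0 j f x)) (regroup x (x ^ j) (eval f x))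
    where
    regroup : ∀ x y v → + 0 + x * (y * v) ≡ x * y * v
    regroup = solve-∀

  geometric : ℕ → ℤ → ℤ
  geometric zero    y = + 1
  geometric (suc k) y = + 1 + y * geometric k y

  geometric-sum : ∀ k y → (y - + 1) * geometric k y ≡ y ^ suc k - + 1
  geometric-sum zero    y = base y
    where
    base : ∀ y → (y - + 1) * + 1 ≡ y * + 1 - + 1
    base = solve-∀
  geometric-sum (suc k) y = trans (expand y (geometric k y)) (trans (cong (λ v → y * v + (y - + 1)) (geometric-sum k y)) (collect y (y ^ suc k)))
    where
    expand : ∀ y g → (y - + 1) * (+ 1 + y * g) ≡ y * ((y - + 1) * g) + (y - + 1)
    expand = solve-∀
    collect : ∀ y z → y * (z - + 1) + (y - + 1) ≡ y * z - + 1
    collect = solve-∀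

  -- monic (sparse-geometric d′ k) is the polynomial 1 + x^d + x^(2d) + ... + x^(kd), with d = suc d′.
  sparse-geometric : ℕ → ℕ → List ℤ
  sparse-geometric d′ zero    = []
  sparse-geometric d′ (suc k) = (+ 1 ∷ replicate d′ (+ 0)) ++ sparse-geometric d′ k

  length-sparse-geometric : ∀ d′ k → length (sparse-geometric d′ k) ≡ suc d′ ℕ.* k
  length-sparse-geometric d′ zero    = sym (ℕₚ.*-zeroʳ (suc d′))
  length-sparse-geometric d′ (suc k) = begin
      length ((+ 1 ∷ replicate d′ (+ 0)) ++ sparse-geometric d′ k)
    ≡⟨ Listₚ.length-++ (+ 1 ∷ replicate d′ (+ 0)) ⟩
      suc (length (replicate d′ (+ 0))) ℕ.+ length (sparse-geometric d′ k)
    ≡⟨ cong₂ (λ u v → suc u ℕ.+ v) (Listₚ.length-replicate d′) (length-sparse-geometric d′ k) ⟩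
      suc d′ ℕ.+ suc d′ ℕ.* k
    ≡⟨ sym (ℕₚ.*-suc (suc d′) k) ⟩
      suc d′ ℕ.* suc k ∎
    where open ≡-Reasoning

  eval-sparse-geometric : ∀ d′ k x → eval (monic (sparse-geometric d′ k)) x ≡ geometric k (x ^ suc d′)
  eval-sparse-geometric d′ zero    x = eval-monic-[] x
  eval-sparse-geometric d′ (suc k) x = begin
      eval (monic ((+ 1 ∷ replicate d′ (+ 0)) ++ sparse-geometric d′ k)) x
    ≡⟨ cong (λ f → eval f x) (Listₚ.++-assoc (+ 1 ∷ replicate d′ (+ 0)) (sparse-geometric d′ k) _) ⟩
      + 1 + x * eval (replicate d′ (+ 0) ++ monic (sparse-geometric d′ k)) x
    ≡⟨ cong (λ v → + 1 + x * v) (eval-replicate-0 d′ _ x) ⟩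
      + 1 + x * (x ^ d′ * eval (monic (sparse-geometric d′ k)) x)
    ≡⟨ cong (λ v → + 1 + x * (x ^ d′ * v)) (eval-sparse-geometric d′ k x) ⟩
      + 1 + x * (x ^ d′ * geometric k (x ^ suc d′))
    ≡⟨ cong (_+_ (+ 1)) (sym (ℤₚ.*-assoc x (x ^ d′) _)) ⟩
      geometric (suc k) (x ^ suc d′) ∎
    where open ≡-Reasoning

  coeff-+ₚ : ∀ f g i → coeff (f +ₚ g) i ≡ coeff f i + coeff g i
  coeff-+ₚ []      g       i       = sym (ℤₚ.+-identityˡ _)
  coeff-+ₚ (a ∷ f) []      i       = sym (ℤₚ.+-identityʳ _)
  coeff-+ₚ (a ∷ f) (b ∷ g) zero    = refl
  coeff-+ₚ (a ∷ f) (b ∷ g) (suc i) = coeff-+ₚ f g i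

  coeff-map-* : ∀ c f i → coeff (map (c *_) f) i ≡ c * coeff f i
  coeff-map-* c []      i       = sym (ℤₚ.*-zeroʳ c)
  coeff-map-* c (a ∷ f) zero    = refl
  coeff-map-* c (a ∷ f) (suc i) = coeff-map-* c f i

  coeff--ₚ : ∀ f i → coeff (-ₚ f) i ≡ - coeff f i
  coeff--ₚ []      i       = refl
  coeff--ₚ (a ∷ f) zero    = refl
  coeff--ₚ (a ∷ f) (suc i) = coeff--ₚ f i

  coeff-∷-*ₚ : ∀ a w f i → coeff ((a ∷ w) *ₚ f) i ≡ a * coeff f i + coeff (+ 0 ∷ (w *ₚ f)) i
  coeff-∷-*ₚ a w f i = trans (coeff-+ₚ (map (a *_) f) _ i) (cong (_+ coeff (+ 0 ∷ (w *ₚ f)) i) (coeff-map-* a f i))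

  coeff-1-*ₚ : ∀ f i → coeff ((+ 1 ∷ []) *ₚ f) i ≡ coeff f i
  coeff-1-*ₚ f i = trans (coeff-∷-*ₚ (+ 1) [] f i) (trans (cong (_+ coeff (+ 0 ∷ []) i) (ℤₚ.*-identityˡ (coeff f i))) (drop-zero i))
    where
    drop-zero : ∀ i → coeff f i + coeff (+ 0 ∷ []) i ≡ coeff f i
    drop-zero zero    = ℤₚ.+-identityʳ _
    drop-zero (suc i) = ℤₚ.+-identityʳ _

  *ₚ-congˡ : ∀ {m} w f g → (∀ k → coeff f k ≈[ m ] coeff g k) → ∀ k → coeff (w *ₚ f) k ≈[ m ] coeff (w *ₚ g) k
  *ₚ-congˡ []      f g f≈g k = ≈-refl
  *ₚ-congˡ (a ∷ w) f g f≈g k =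
    ≈-trans (≈-reflexive (coeff-∷-*ₚ a w f k))
      (≈-trans (+-cong (*-congˡ a (f≈g k)) (shifted k)) (≈-reflexive (sym (coeff-∷-*ₚ a w g k))))
    where
    shifted : ∀ k → coeff (+ 0 ∷ (w *ₚ f)) k ≈[ _ ] coeff (+ 0 ∷ (w *ₚ g)) k
    shifted zero    = ≈-refl
    shifted (suc k) = *ₚ-congˡ w f g f≈g k

  eval-*ₚ : ∀ w f x → eval (w *ₚ f) x ≡ eval w x * eval f x
  eval-*ₚ []      f x = refl
  eval-*ₚ (a ∷ w) f x =
    trans (eval-+ₚ (map (a *_) f) _ x)
          (trans (cong₂ _+_ (eval-map-* a f x) (cong (λ v → + 0 + x * v) (eval-*ₚ w f x))) (regroup a x (eval w x) (eval f x)))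
    where
    regroup : ∀ a x w f → a * f + (+ 0 + x * (w * f)) ≡ (a + x * w) * f
    regroup = solve-∀

  eval-[0] : ∀ x → eval (+ 0 ∷ []) x ≡ + 0
  eval-[0] x = trans (ℤₚ.+-identityˡ _) (ℤₚ.*-zeroʳ x)

  eval-cong : ∀ {m} f g x → (∀ i → coeff f i ≈[ m ] coeff g i) → eval f x ≈[ m ] eval g x
  eval-cong []      []      x f≈g = ≈-refl
  eval-cong []      (b ∷ g) x f≈g =
    ≈-trans (≈-reflexive (sym (eval-[0] x))) (+-cong (f≈g 0) (*-congˡ x (eval-cong [] g x (λ i → f≈g (suc i)))))
  eval-cong (a ∷ f) []      x f≈g =
    ≈-trans (+-cong (f≈g 0) (*-congˡ x (eval-cong f [] x (λ i → f≈g (suc i))))) (≈-reflexive (eval-[0] x))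
  eval-cong (a ∷ f) (b ∷ g) x f≈g = +-cong (f≈g 0) (*-congˡ x (eval-cong f g x (λ i → f≈g (suc i))))


  eval-Xpow : ∀ n x → eval (Xpow n) x ≡ x ^ n
  eval-Xpow n x = trans (eval-replicate-0 n (monic []) x) (trans (cong (x ^ n *_) (eval-monic-[] x)) (ℤₚ.*-identityʳ _))

  eval--ₚ : ∀ f x → eval (-ₚ f) x ≡ - eval f x
  eval--ₚ []      x = refl
  eval--ₚ (a ∷ f) x = trans (cong (λ v → - a + x * v) (eval--ₚ f x)) (regroup a x (eval f x))
    where
    regroup : ∀ a x v → - a + x * (- v) ≡ - (a + x * v)
    regroup = solve-∀

  eval-XnMinusX : ∀ n x → eval (XnMinusX n) x ≡ x ^ n - x
  eval-XnMinusX n x = trans (eval-+ₚ (Xpow n) _ x)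
    (cong₂ _+_ (eval-Xpow n x) (trans (eval--ₚ (Xpow 1) x) (cong -_ (trans (eval-Xpow 1 x) (ℤₚ.*-identityʳ x)))))

  eval-quad-0 : ∀ b c → eval (quad b c) (+ 0) ≡ c
  eval-quad-0 b c = ℤₚ.+-identityʳ c

  eval-quad : ∀ b c x → eval (quad b c) x ≡ c + b * x + x * x
  eval-quad b c x = expand b c x
    where
    expand : ∀ b c x → c + x * (b + x * (+ 1 + x * + 0)) ≡ c + b * x + x * x
    expand = solve-∀

  disc-≈ : ∀ {m b c} α β → b ≈[ m ] - (α + β) → c ≈[ m ] α * β → disc b c ≈[ m ] (α - β) * (α - β)
  disc-≈ α β b≈ c≈ = ≈-trans (-cong (*-cong b≈ b≈) (*-congˡ (+ 4) c≈)) (≈-reflexive (vieta α β))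
    where
    vieta : ∀ α β → - (α + β) * - (α + β) - + 4 * (α * β) ≡ (α - β) * (α - β)
    vieta = solve-∀

  -- a is a root of (x - a′)(x - b′), which has the same coefficients as (x - a)(x - b).
  same-sum-product : ∀ {m} a b a′ b′ → a + b ≈[ m ] a′ + b′ → a * b ≈[ m ] a′ * b′ → (a - a′) * (a - b′) ≈[ m ] + 0
  same-sum-product {m} a b a′ b′ sum≈ product≈ = begin
      (a - a′) * (a - b′)               ≡⟨ expand a a′ b′ ⟩
      a * a - a * (a′ + b′) + a′ * b′   ≈⟨ +-cong (-cong (≈-refl {a = a * a}) (*-congˡ a (≈-sym sum≈))) (≈-sym product≈) ⟩
      a * a - a * (a + b) + a * b       ≡⟨ cancel a b ⟩
      + 0                               ∎
    where
    open ≈-Reasoning m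
    expand : ∀ a a′ b′ → (a - a′) * (a - b′) ≡ a * a - a * (a′ + b′) + a′ * b′
    expand = solve-∀
    cancel : ∀ a b → a * a - a * (a + b) + a * b ≡ + 0
    cancel = solve-∀

  module Cofactor (α β : ℤ) where

    -- h k is the complete homogeneous symmetric polynomial of degree k in α and β.
    h : ℕ → ℤ
    h zero    = + 1
    h (suc k) = α ^ suc k + β * h k

    h-difference : ∀ k → (α - β) * h k ≡ α ^ suc k - β ^ suc k
    h-difference zero    = base α β
      where
      base : ∀ a b → (a - b) * + 1 ≡ a * + 1 - b * + 1
      base = solve-∀
    h-difference (suc k) = trans (expand α β (α ^ suc k) (h k))
      (trans (cong (λ v → (α - β) * α ^ suc k + β * v) (h-difference k)) (collect α β (α ^ suc k) (β ^ suc k)))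
      where
      expand : ∀ a b x y → (a - b) * (x + b * y) ≡ (a - b) * x + b * ((a - b) * y)
      expand = solve-∀
      collect : ∀ a b x y → (a - b) * x + b * (x - y) ≡ a * x - b * y
      collect = solve-∀

    h-recurrence : ∀ k → h (suc (suc k)) ≡ (α + β) * h (suc k) - α * β * h k
    h-recurrence k = identity α β (α ^ suc k) (h k)
      where
      identity : ∀ a b x y → a * x + b * (x + b * y) ≡ (a + b) * (x + b * y) - a * b * y
      identity = solve-∀

    f : Poly
    f = quad (- (α + β)) (α * β)

    cofactor : ℕ → Poly
    cofactor zero    = + 1 ∷ []
    cofactor (suc M) = h (suc M) ∷ cofactor M

    -- The polynomial x^(M+2) - h (M+1) x + α β h M.
    remainder : ℕ → Poly
    remainder M = α * β * h M ∷ - h (suc M) ∷ Xpow M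

    cofactor-*ₚ : ∀ M k → coeff (cofactor M *ₚ f) k ≡ coeff (remainder M) k
    cofactor-*ₚ zero    k = trans (coeff-1-*ₚ f k) (base k)
      where
      base : ∀ k → coeff f k ≡ coeff (remainder 0) k
      base zero                = sym (ℤₚ.*-identityʳ (α * β))
      base (suc zero)          = cong -_ (sym (cong₂ _+_ (ℤₚ.*-identityʳ α) (ℤₚ.*-identityʳ β)))
      base (suc (suc zero))    = refl
      base (suc (suc (suc k))) = refl
    cofactor-*ₚ (suc M) k = trans (coeff-∷-*ₚ (h (suc M)) (cofactor M) f k) (step k)
      where
      step : ∀ k → h (suc M) * coeff f k + coeff (+ 0 ∷ (cofactor M *ₚ f)) k ≡ coeff (remainder (suc M)) k
      step zero                = trans (ℤₚ.+-identityʳ _) (ℤₚ.*-comm (h (suc M)) (α * β))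
      step (suc zero)          = trans (cong (_+_ (h (suc M) * - (α + β))) (cofactor-*ₚ M 0))
        (trans (regroup α β (h (suc M)) (h M)) (cong -_ (sym (h-recurrence M))))
        where
        regroup : ∀ a b x y → x * - (a + b) + a * b * y ≡ - ((a + b) * x - a * b * y)
        regroup = solve-∀
      step (suc (suc zero))    = trans (cong (_+_ (h (suc M) * + 1)) (cofactor-*ₚ M 1)) (cancel (h (suc M)))
        where
        cancel : ∀ x → x * + 1 + - x ≡ + 0
        cancel = solve-∀
      step (suc (suc (suc j))) = trans (cong (_+_ (h (suc M) * + 0)) (cofactor-*ₚ M (suc (suc j))))
        (trans (cong (_+ coeff (Xpow M) j) (ℤₚ.*-zeroʳ (h (suc M)))) (ℤₚ.+-identityˡ _))

    -- If α, β are (M+1)-th roots of unity with α - β invertible, then h M ≈ 0 and h (M+1) ≈ 1,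
    -- so the remainder is x^(M+2) - x.
    divides-x^n-x : ∀ {m} u M → u * (α - β) ≈[ m ] + 1 → α ^ suc M ≈[ m ] + 1 → β ^ suc M ≈[ m ] + 1
                  → ∀ i → coeff (XnMinusX (suc (suc M))) i ≈[ m ] coeff (cofactor M *ₚ f) i
    divides-x^n-x {m} u M u[α-β]≈1 α^N≈1 β^N≈1 i =
      ≈-trans (≈-reflexive (trans (coeff-+ₚ (Xpow (suc (suc M))) (-ₚ (Xpow 1)) i) (cong (_+_ (coeff (Xpow (suc (suc M))) i)) (coeff--ₚ (Xpow 1) i))))
        (≈-trans (compare i) (≈-reflexive (sym (cofactor-*ₚ M i))))
      where
      divide : ∀ {a b} → (α - β) * a ≈[ m ] b → a ≈[ m ] u * b
      divide {a} {b} [α-β]a≈b = begin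
          a                     ≡⟨ sym (ℤₚ.*-identityˡ a) ⟩
          + 1 * a               ≈⟨ *-cong (≈-sym u[α-β]≈1) ≈-refl ⟩
          u * (α - β) * a       ≡⟨ ℤₚ.*-assoc u (α - β) a ⟩
          u * ((α - β) * a)     ≈⟨ *-congˡ u [α-β]a≈b ⟩
          u * b                 ∎
        where open ≈-Reasoning m
      u[1-1]≡0 : ∀ u → u * (+ 1 - + 1) ≡ + 0
      u[1-1]≡0 = solve-∀
      u[α1-β1]≡u[α-β] : ∀ u a b → u * (a * + 1 - b * + 1) ≡ u * (a - b)
      u[α1-β1]≡u[α-β] = solve-∀
      h-M≈0 : h M ≈[ m ] + 0
      h-M≈0 = ≈-trans (divide (≈-trans (≈-reflexive (h-difference M)) (-cong α^N≈1 β^N≈1)))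
                      (≈-reflexive (u[1-1]≡0 u))
      h-M+1≈1 : h (suc M) ≈[ m ] + 1
      h-M+1≈1 = ≈-trans (divide (≈-trans (≈-reflexive (h-difference (suc M))) (-cong (*-congˡ α α^N≈1) (*-congˡ β β^N≈1))))
                        (≈-trans (≈-reflexive (u[α1-β1]≡u[α-β] u α β)) u[α-β]≈1)
      compare : ∀ i → coeff (Xpow (suc (suc M))) i + - coeff (Xpow 1) i ≈[ m ] coeff (remainder M) i
      compare zero          = ≈-sym (≈-trans (*-congˡ (α * β) h-M≈0) (≈-reflexive (ℤₚ.*-zeroʳ (α * β))))
      compare (suc zero)    = -‿cong (≈-sym h-M+1≈1)
      compare (suc (suc j)) = ≈-reflexive (ℤₚ.+-identityʳ _)

  quad-cong : ∀ {m b c b′ c′} → b ≈[ m ] b′ → c ≈[ m ] c′ → ∀ i → coeff (quad b c) i ≈[ m ] coeff (quad b′ c′) i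
  quad-cong b≈b′ c≈c′ zero          = c≈c′
  quad-cong b≈b′ c≈c′ (suc zero)    = b≈b′
  quad-cong b≈b′ c≈c′ (suc (suc i)) = ≈-refl

  gcmd-self : ∀ {m} g f → (Σ Poly λ w → g ≡ₚ w *ₚ f [mod m ]) → GcmdIs m g f f
  gcmd-self {m} g f f∣g =
    ([] , + 1 ∷ [] , λ i → ≈⇒≡[mod] (≈-reflexive (coeff-1-*ₚ f i))) ,
    f∣g ,
    (+ 1 ∷ [] , λ i → ≈⇒≡[mod] (≈-reflexive (sym (coeff-1-*ₚ f i))))

  gcmd-roots-of-unity : ∀ {m} α β u M b c → u * (α - β) ≈[ m ] + 1 → α ^ suc M ≈[ m ] + 1 → β ^ suc M ≈[ m ] + 1
                      → b ≈[ m ] - (α + β) → c ≈[ m ] α * β → GcmdIs m (XnMinusX (suc (suc M))) (quad b c) (quad b c)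
  gcmd-roots-of-unity α β u M b c u[α-β]≈1 α^N≈1 β^N≈1 b≈ c≈ = gcmd-self _ _ (cofactor M , λ i →
    ≈⇒≡[mod] (≈-trans (divides-x^n-x u M u[α-β]≈1 α^N≈1 β^N≈1 i)
                       (*ₚ-congˡ (cofactor M) f (quad b c) (quad-cong (≈-sym b≈) (≈-sym c≈)) i)))
    where open Cofactor α β

  gcmd⇒root : ∀ {m} n f x → GcmdIs m (XnMinusX n) f f → eval f x ≈[ m ] + 0 → x ^ n - x ≈[ m ] + 0
  gcmd⇒root {m} n f x (_ , (w , x^n-x≡wf) , _) fx≈0 = begin
      x ^ n - x             ≡⟨ sym (eval-XnMinusX n x) ⟩
      eval (XnMinusX n) x   ≈⟨ eval-cong (XnMinusX n) (w *ₚ f) x (λ i → ≡[mod]⇒≈ (x^n-x≡wf i)) ⟩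
      eval (w *ₚ f) x       ≡⟨ eval-*ₚ w f x ⟩
      eval w x * eval f x   ≈⟨ *-congˡ (eval w x) fx≈0 ⟩
      eval w x * + 0        ≡⟨ ℤₚ.*-zeroʳ (eval w x) ⟩
      + 0                   ∎
    where open ≈-Reasoning m

  IsRootOfUnity : ℕ → ℕ → ℕ → Set
  IsRootOfUnity m N a = ((+ a) ^ N) ≡ (+ 1) [mod m ]

  isRootOfUnity? : ∀ m N → Decidable (IsRootOfUnity m N)
  isRootOfUnity? m N a = m ℕ∣.∣? ∣ (+ a) ^ N - + 1 ∣

  roots-of-unity : ℕ → ℕ → List ℕ
  roots-of-unity m N = filter (isRootOfUnity? m N) (upTo m)

  roots-of-unity-unique : ∀ m N → Unique (roots-of-unity m N)
  roots-of-unity-unique m N = Uniqueₚ.filter⁺ (isRootOfUnity? m N) (Uniqueₚ.upTo⁺ m)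

  module _ (m N : ℕ) where

    ∈-roots-of-unity⁻ : ∀ {a} → a ∈ roots-of-unity m N → a ℕ.< m × (+ a) ^ N ≈[ m ] + 1
    ∈-roots-of-unity⁻ a∈ with ∈-filter⁻ (isRootOfUnity? m N) {xs = upTo m} a∈
    ... | a∈upTo , root = ∈-upTo⁻ a∈upTo , ≡[mod]⇒≈ root

    ∈-roots-of-unity⁺ : ∀ {a} → a ℕ.< m → (+ a) ^ N ≈[ m ] + 1 → a ∈ roots-of-unity m N
    ∈-roots-of-unity⁺ a<m root = ∈-filter⁺ (isRootOfUnity? m N) (∈-upTo⁺ a<m) (≈⇒≡[mod] root)

  -- Arithmetic modulo a prime p

  prime⇒1< : ∀ {p} → Prime p → 1 ℕ.< p
  prime⇒1< {p} (prime _) = ℕ.nonTrivial⇒n>1 p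

  module PrimeModulus {p′ : ℕ} (p-prime : Prime (suc p′)) where

    p : ℕ
    p = suc p′

    1<p : 1 ℕ.< p
    1<p = prime⇒1< p-prime

    infix 4 p∤_
    p∤_ : ℤ → Set
    p∤ a = ¬ (+ p ∣ℤ a)

    p∣*⇒p∣⊎p∣ : ∀ {a b} → + p ∣ℤ a * b → + p ∣ℤ a ⊎ + p ∣ℤ b
    p∣*⇒p∣⊎p∣ {a} {b} p∣ab with euclidsLemma ∣ a ∣ ∣ b ∣ p-prime (subst (p ℕ∣.∣_) (ℤₚ.abs-* a b) (∣⇒∣ᵤ p∣ab))
    ... | inj₁ p∣a = inj₁ (∣ᵤ⇒∣ p∣a)
    ... | inj₂ p∣b = inj₂ (∣ᵤ⇒∣ p∣b)

    p∤∧p∣*⇒p∣ : ∀ {a b} → p∤ a → + p ∣ℤ a * b → + p ∣ℤ b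
    p∤∧p∣*⇒p∣ p∤a p∣ab with p∣*⇒p∣⊎p∣ p∣ab
    ... | inj₁ p∣a = ⊥-elim (p∤a p∣a)
    ... | inj₂ p∣b = p∣b

    p∤1 : p∤ + 1
    p∤1 p∣1 = ℕₚ.<⇒≢ 1<p (sym (ℕ∣.∣1⇒≡1 (∣⇒∣ᵤ p∣1)))

    p∤-* : ∀ {a b} → p∤ a → p∤ b → p∤ (a * b)
    p∤-* p∤a p∤b p∣ab = p∤b (p∤∧p∣*⇒p∣ p∤a p∣ab)

    p∤-^ : ∀ {a} k → p∤ a → p∤ (a ^ k)
    p∤-^ zero    p∤a = p∤1
    p∤-^ (suc k) p∤a = p∤-* p∤a (p∤-^ k p∤a)

    p∤-resp-≈ : ∀ {a b} → a ≈[ p ] b → p∤ b → p∤ a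
    p∤-resp-≈ a≈b p∤b p∣a = p∤b (∣-resp-≈ a≈b p∣a)

    p∣n⇒p∤n-1 : ∀ M → p ℕ∣.∣ suc (suc M) → p∤ + suc M
    p∣n⇒p∤n-1 M p∣n p∣n-1 = p∤1 (∣ᵤ⇒∣ (ℕ∣.∣m+n∣m⇒∣n (subst (p ℕ∣.∣_) (ℕₚ.+-comm 1 (suc M)) p∣n) (∣⇒∣ᵤ p∣n-1)))

    odd⇒p∤2 : ¬ 2 ℕ∣.∣ p → p∤ + 2
    odd⇒p∤2 2∤p p∣2 = 2∤p (subst (ℕ∣._∣ p) (ℕₚ.≤-antisym (ℕ∣.∣⇒≤ (∣⇒∣ᵤ p∣2)) 1<p) ℕ∣.∣-refl)

    0<k<p⇒p∤k : ∀ {k} → 0 ℕ.< k → k ℕ.< p → p∤ + k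
    0<k<p⇒p∤k {suc k} _ k<p p∣k = ℕₚ.<⇒≱ k<p (ℕ∣.∣⇒≤ (∣⇒∣ᵤ p∣k))

    p∣pCk : ∀ k → 0 ℕ.< k → k ℕ.< p → + p ∣ℤ + (p C k)
    p∣pCk (suc k) 0<k k<p with euclidsLemma (suc k) (p C suc k) p-prime
                                 (ℕ∣.divides (p′ C k) (trans (C-absorption p′ k) (ℕₚ.*-comm p _)))
    ... | inj₁ p∣k   = ⊥-elim (0<k<p⇒p∤k 0<k k<p (∣ᵤ⇒∣ p∣k))
    ... | inj₂ p∣pCk = ∣ᵤ⇒∣ p∣pCk

    freshmans-dream : ∀ x → (+ 1 + x) ^ p ≈[ p ] + 1 + x ^ p
    freshmans-dream x = mk≈ (subst (_ ∣ℤ_) (sym middle-terms) (∑-∣ p′ _ p∣term))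
      where
      term : ℕ → ℤ
      term k = + (p C k) * x ^ k
      p∣term : ∀ k → k ℕ.< p′ → + p ∣ℤ term (suc k)
      p∣term k k<p′ = ℤ∣.∣m⇒∣m*n (x ^ suc k) (p∣pCk (suc k) (s≤s z≤n) (s≤s k<p′))
      middle-terms : (+ 1 + x) ^ p - (+ 1 + x ^ p) ≡ ∑ p′ (λ k → term (suc k))
      middle-terms = begin
          (+ 1 + x) ^ p - (+ 1 + x ^ p)
        ≡⟨ cong (_- (+ 1 + x ^ p)) (binomial-theorem x p (suc p) (ℕₚ.n<1+n p)) ⟩
          term 0 + ∑ p (λ k → term (suc k)) - (+ 1 + x ^ p)
        ≡⟨ cong (λ s → term 0 + s - (+ 1 + x ^ p)) (∑-last p′ (λ k → term (suc k))) ⟩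
          term 0 + (S + term p) - (+ 1 + x ^ p)
        ≡⟨ cong (λ c → term 0 + (S + + c * x ^ p) - (+ 1 + x ^ p)) (nCn≡1 p) ⟩
          + 1 * + 1 + (S + + 1 * x ^ p) - (+ 1 + x ^ p)
        ≡⟨ cancel S (x ^ p) ⟩
          S ∎
        where
        open ≡-Reasoning
        S = ∑ p′ (λ k → term (suc k))
        cancel : ∀ s y → + 1 * + 1 + (s + + 1 * y) - (+ 1 + y) ≡ s
        cancel = solve-∀

    fermat : ∀ z → z ^ p ≈[ p ] z
    fermat z = ≈-trans (^-cong p (≈-sym (%ℕ-≈ z p))) (≈-trans (fermatℕ (z %ℕ p)) (%ℕ-≈ z p))
      where
      fermatℕ : ∀ a → (+ a) ^ p ≈[ p ] + a
      fermatℕ zero    = ≈-reflexive (ℤₚ.*-zeroˡ ((+ 0) ^ p′))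
      fermatℕ (suc a) = ≈-trans (freshmans-dream (+ a)) (+-cong (≈-refl {a = + 1}) (fermatℕ a))

    fermat-unit : ∀ z → p∤ z → z ^ p′ ≈[ p ] + 1
    fermat-unit z p∤z = mk≈ (p∤∧p∣*⇒p∣ p∤z (subst (_ ∣ℤ_) (factor z (z ^ p′)) (∣diff (fermat z))))
      where
      factor : ∀ z y → z * y - z ≡ z * (y - + 1)
      factor = solve-∀

    inverse-mod-p : ∀ z → p∤ z → ∃ λ y → z * y ≈[ p ] + 1
    inverse-mod-p z p∤z = z ^ ℕ.pred p′ , subst (λ k → z ^ k ≈[ p ] + 1) (sym (ℕₚ.suc-pred p′ {{p′≢0}})) (fermat-unit z p∤z)
      where
      p′≢0 : NonZero p′
      p′≢0 = ℕ.>-nonZero (ℕₚ.≤-pred 1<p)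

    -- Hensel lifting

    p∣p^suc : ∀ k → p ℕ∣.∣ p ℕ.^ suc k
    p∣p^suc k = ℕ∣.m∣m*n {p} (p ℕ.^ k)

    p^k∣p^suc-k : ∀ k → p ℕ.^ k ℕ∣.∣ p ℕ.^ suc k
    p^k∣p^suc-k k = ℕ∣.n∣m*n p {p ℕ.^ k}

    ≈[p]⇒≈[p^1] : ∀ {a b} → a ≈[ p ] b → a ≈[ p ℕ.^ 1 ] b
    ≈[p]⇒≈[p^1] = ≈-weaken (ℕ∣.∣-reflexive (ℕₚ.*-identityʳ p))

    inverse-mod-p^ : ∀ z → p∤ z → ∀ k → ∃ λ y → z * y ≈[ p ℕ.^ suc k ] + 1
    inverse-mod-p^ z p∤z zero    = Product.map₂ ≈[p]⇒≈[p^1] (inverse-mod-p z p∤z)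
    inverse-mod-p^ z p∤z (suc k) = refine (inverse-mod-p^ z p∤z k)
      where
      newton : ∀ z y → - ((z * y - + 1) * (z * y - + 1)) ≡ z * (y * (+ 2 - z * y)) - + 1
      newton = solve-∀
      refine : (∃ λ y → z * y ≈[ p ℕ.^ suc k ] + 1) → ∃ λ y → z * y ≈[ p ℕ.^ suc (suc k) ] + 1
      refine (y , mk≈ q∣zy-1) =
        y * (+ 2 - z * y) , mk≈ (subst (_ ∣ℤ_) (newton z y) (ℤ∣.∣m⇒∣-m (∣-square _ (p∣p^suc k) q∣zy-1)))

    hensel-step : ∀ {q} n c a → p ℕ∣.∣ q → p∤ + suc n * a ^ n → a ^ suc n ≈[ q ] c
                → ∃ λ a′ → a′ ≈[ q ] a × a′ ^ suc n ≈[ p ℕ.* q ] c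
    -- Newton's step a′ = a - (a ^ suc n - c) / f′(a), where the derivative f′(a) need only be inverted mod p.
    hensel-step {q} n c a (ℕ∣.divides s′ q≡s′p) p∤f′ (mk≈ (divides t fa≡tq)) = newton-step (inverse-mod-p f′ p∤f′)
      where
      f′ = + suc n * a ^ n
      newton-step : (∃ λ u → f′ * u ≈[ p ] + 1) → ∃ λ a′ → a′ ≈[ q ] a × a′ ^ suc n ≈[ p ℕ.* q ] c
      newton-step (u , mk≈ (divides s f′u≡sp)) =
        a + e , mk≈ (divides (- (t * u)) (shift a e)) , mk≈ (divides (- (t * s) + t * t * u * u * R * + s′) lifted)
        where
        open ≡-Reasoning
        e = - (t * u) * + q
        R = proj₁ (^-taylor a e n)
        shift : ∀ a e → (a + e) - a ≡ e
        shift = solve-∀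
        expand : ∀ A c X u t R Q → A + X * (- (t * u) * Q) + (- (t * u) * Q) * (- (t * u) * Q) * R - c
                                 ≡ (A - c) - t * Q - t * Q * (X * u - + 1) + t * t * u * u * R * (Q * Q)
        expand = solve-∀
        collect : ∀ t u s s′ R P Q → t * Q - t * Q - t * Q * (s * P) + t * t * u * u * R * (Q * (s′ * P))
                                   ≡ (- (t * s) + t * t * u * u * R * s′) * (P * Q)
        collect = solve-∀
        lifted : (a + e) ^ suc n - c ≡ (- (t * s) + t * t * u * u * R * + s′) * + (p ℕ.* q)
        lifted = begin
            (a + e) ^ suc n - c
          ≡⟨ cong (_- c) (proj₂ (^-taylor a e n)) ⟩
            a ^ suc n + f′ * e + e * e * R - c
          ≡⟨ expand (a ^ suc n) c f′ u t R (+ q) ⟩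
            (a ^ suc n - c) - t * + q - t * + q * (f′ * u - + 1) + t * t * u * u * R * (+ q * + q)
          ≡⟨ cong₂ (λ x y → x - t * + q - t * + q * y + t * t * u * u * R * (+ q * + q)) fa≡tq f′u≡sp ⟩
            t * + q - t * + q - t * + q * (s * + p) + t * t * u * u * R * (+ q * + q)
          ≡⟨ cong (λ x → t * + q - t * + q - t * + q * (s * + p) + t * t * u * u * R * (+ q * x))
                  (trans (cong +_ q≡s′p) (ℤₚ.pos-* s′ p)) ⟩
            t * + q - t * + q - t * + q * (s * + p) + t * t * u * u * R * (+ q * (+ s′ * + p))
          ≡⟨ collect t u s (+ s′) R (+ p) (+ q) ⟩
            (- (t * s) + t * t * u * u * R * + s′) * (+ p * + q)
          ≡⟨ cong ((- (t * s) + t * t * u * u * R * + s′) *_) (sym (ℤₚ.pos-* p q)) ⟩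
            (- (t * s) + t * t * u * u * R * + s′) * + (p ℕ.* q) ∎

    hensel : ∀ n c a → p∤ + suc n → p∤ a → a ^ suc n ≈[ p ] c
           → ∀ k → ∃ λ a′ → a′ ≈[ p ] a × a′ ^ suc n ≈[ p ℕ.^ suc k ] c
    hensel n c a p∤N p∤a fa≈c zero = a , ≈-refl , ≈[p]⇒≈[p^1] fa≈c
    hensel n c a p∤N p∤a fa≈c (suc k) = lift (hensel n c a p∤N p∤a fa≈c k)
      where
      lift : (∃ λ a′ → a′ ≈[ p ] a × a′ ^ suc n ≈[ p ℕ.^ suc k ] c)
           → ∃ λ a″ → a″ ≈[ p ] a × a″ ^ suc n ≈[ p ℕ.^ suc (suc k) ] c
      lift (a′ , a′≈a , fa′≈c) =
        let a″ , a″≈a′ , fa″≈c = hensel-step n c a′ (p∣p^suc k) (p∤-* p∤N (p∤-^ n (p∤-resp-≈ a′≈a p∤a))) fa′≈c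
        in  a″ , ≈-trans (≈-weaken (p∣p^suc k) a″≈a′) a′≈a , fa″≈c

    -- With a - b = t q, subtracting the Taylor expansions at b gives p q ∣ f′(b) t q, hence p ∣ t.
    hensel-unique-step : ∀ {q} .{{_ : NonZero q}} n a b → p ℕ∣.∣ q → p∤ + suc n * b ^ n
                       → a ≈[ q ] b → a ^ suc n ≈[ p ℕ.* q ] b ^ suc n → a ≈[ p ℕ.* q ] b
    hensel-unique-step {q} n a b p∣q p∤f′ (mk≈ (divides t a-b≡tq)) (mk≈ pq∣fa-fb) =
      conclude (p∤∧p∣*⇒p∣ p∤f′ (ℤ∣.*-cancelʳ-∣ (+ q) (subst₂ _∣ℤ_ (ℤₚ.pos-* p q) f′e≡f′t*q pq∣f′e)))
      where
      f′ = + suc n * b ^ n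
      e = a - b
      R = proj₁ (^-taylor b e n)
      taylor : a ^ suc n ≡ b ^ suc n + f′ * e + e * e * R
      taylor = trans (cong (_^ suc n) (sym (restore a b))) (proj₂ (^-taylor b e n))
        where
        restore : ∀ a b → b + (a - b) ≡ a
        restore = solve-∀
      isolate : ∀ A B F e R → A ≡ B + F * e + e * e * R → A - B - e * e * R ≡ F * e
      isolate .(B + F * e + e * e * R) B F e R refl = cancel B F e R
        where
        cancel : ∀ B F e R → B + F * e + e * e * R - B - e * e * R ≡ F * e
        cancel = solve-∀
      f′e≡f′t*q : f′ * e ≡ f′ * t * + q
      f′e≡f′t*q = trans (cong (f′ *_) a-b≡tq) (sym (ℤₚ.*-assoc f′ t (+ q)))
      pq∣f′e : + (p ℕ.* q) ∣ℤ f′ * e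
      pq∣f′e = subst (_ ∣ℤ_) (isolate _ _ f′ e R taylor)
                 (ℤ∣.∣m∣n⇒∣m-n pq∣fa-fb (ℤ∣.∣m⇒∣m*n R (∣-square e p∣q (divides t a-b≡tq))))
      conclude : + p ∣ℤ t → a ≈[ p ℕ.* q ] b
      conclude (divides t′ t≡t′p) = mk≈ (divides t′ (begin
          a - b               ≡⟨ a-b≡tq ⟩
          t * + q             ≡⟨ cong (_* + q) t≡t′p ⟩
          t′ * + p * + q      ≡⟨ ℤₚ.*-assoc t′ (+ p) (+ q) ⟩
          t′ * (+ p * + q)    ≡⟨ cong (t′ *_) (sym (ℤₚ.pos-* p q)) ⟩
          t′ * + (p ℕ.* q)    ∎))
        where open ≡-Reasoning

    hensel-unique : ∀ n a b → p∤ + suc n → p∤ b → a ≈[ p ] b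
                  → ∀ r → a ^ suc n ≈[ p ℕ.^ suc r ] b ^ suc n → a ≈[ p ℕ.^ suc r ] b
    hensel-unique n a b p∤N p∤b a≈b zero    _     = ≈[p]⇒≈[p^1] a≈b
    hensel-unique n a b p∤N p∤b a≈b (suc r) fa≈fb =
      hensel-unique-step {{ℕₚ.m^n≢0 p (suc r)}} n a b (p∣p^suc r) (p∤-* p∤N (p∤-^ n p∤b))
        (hensel-unique n a b p∤N p∤b a≈b r (≈-weaken (p^k∣p^suc-k (suc r)) fa≈fb)) fa≈fb

    -- Lagrange's theorem

    lagrange : ∀ cs xs → AllPairs (λ u v → p∤ u - v) xs → All (λ x → + p ∣ℤ eval (monic cs) x) xs
             → length xs ℕ.≤ length cs
    lagrange cs       []       _                      _           = z≤n
    lagrange []       (x ∷ xs) _                      (p∣1 ∷ _)   = ⊥-elim (p∤1 (subst (_ ∣ℤ_) (eval-monic-[] x) p∣1))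
    lagrange (c ∷ cs) (a ∷ xs) (a≉xs ∷ xs-incongruent) (p∣fa ∷ p∣fxs) with quotient-monic c cs a
    ... | cs′ , quotient≡ , len =
      s≤s (subst (length xs ℕ.≤_) len (lagrange cs′ xs xs-incongruent (All.zipWith root-of-quotient (a≉xs , p∣fxs))))
      where
      f = monic (c ∷ cs)
      flip : ∀ y a → - (y - a) ≡ a - y
      flip = solve-∀
      root-of-quotient : ∀ {y} → p∤ a - y × + p ∣ℤ eval f y → + p ∣ℤ eval (monic cs′) y
      root-of-quotient {y} (p∤a-y , p∣fy) =
        p∤∧p∣*⇒p∣ (λ p∣y-a → p∤a-y (subst (_ ∣ℤ_) (flip y a) (ℤ∣.∣m⇒∣-m p∣y-a)))
          (subst (_ ∣ℤ_) (trans (eval-quotient f a y) (cong (λ g → (y - a) * eval g y) quotient≡)) (ℤ∣.∣m∣n⇒∣m-n p∣fy p∣fa))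

    -- Counting roots of unity modulo p

    roots-of-unity-≤ : ∀ d′ → length (roots-of-unity p (suc d′)) ℕ.≤ suc d′
    roots-of-unity-≤ d′ = begin
        length R             ≡⟨ sym (Listₚ.length-map +_ R) ⟩
        length (map +_ R)    ≤⟨ lagrange cs (map +_ R) (residues-incongruent R (roots-of-unity-unique p d) (All.tabulate (λ a∈R → proj₁ (∈-roots-of-unity⁻ p d a∈R))))
                                  (Allₚ.map⁺ (All.tabulate root)) ⟩
        length cs            ≡⟨ cong suc (Listₚ.length-replicate d′) ⟩
        suc d′               ∎
      where
      open ℕₚ.≤-Reasoning
      d = suc d′
      R = roots-of-unity p d
      cs = - (+ 1) ∷ replicate d′ (+ 0)
      simplify : ∀ x y → - (+ 1) + x * (y * (+ 1 + x * + 0)) ≡ x * y - + 1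
      simplify = solve-∀
      eval-cs : ∀ x → eval (monic cs) x ≡ x ^ d - + 1
      eval-cs x = trans (cong (λ v → - (+ 1) + x * v) (eval-replicate-0 d′ _ x)) (simplify x (x ^ d′))
      root : ∀ {a} → a ∈ R → + p ∣ℤ eval (monic cs) (+ a)
      root {a} a∈R = subst (_ ∣ℤ_) (sym (eval-cs (+ a))) (∣diff (proj₂ (∈-roots-of-unity⁻ p d a∈R)))

    -- The non-roots of x^d - 1 are roots of x (1 + x^d + ... + x^(kd)) = x (x^(p-1) - 1)/(x^d - 1).
    roots-of-unity-≥ : ∀ d′ k → suc d′ ℕ.* suc k ≡ p′ → suc d′ ℕ.≤ length (roots-of-unity p (suc d′))
    roots-of-unity-≥ d′ k d[k+1]≡p′ = ℕₚ.+-cancelʳ-≤ (suc (d ℕ.* k)) d (length R) (begin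
        d ℕ.+ suc (d ℕ.* k)               ≡⟨ trans (ℕₚ.+-suc d _) (cong suc (trans (sym (ℕₚ.*-suc d k)) d[k+1]≡p′)) ⟩
        p                                 ≡⟨ sym (trans (length-filter+length-filter-∁ (isRootOfUnity? p d) (upTo p)) (Listₚ.length-upTo p)) ⟩
        length R ℕ.+ length nonroots      ≤⟨ ℕₚ.+-monoʳ-≤ (length R) nonroots-≤ ⟩
        length R ℕ.+ suc (d ℕ.* k)        ∎)
      where
      open ℕₚ.≤-Reasoning
      d = suc d′
      R = roots-of-unity p d
      nonroot? = ∁? (isRootOfUnity? p d)
      nonroots = filter nonroot? (upTo p)
      cs = + 0 ∷ sparse-geometric d′ k
      eval-cs : ∀ x → eval (monic cs) x ≡ x * geometric k (x ^ d)
      eval-cs x = trans (cong (λ v → + 0 + x * v) (eval-sparse-geometric d′ k x)) (ℤₚ.+-identityˡ _)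
      root : ∀ {a} → a ∈ nonroots → + p ∣ℤ + a * geometric k ((+ a) ^ d)
      root {a} a∈ with + p ℤ∣.∣? + a
      ... | yes p∣a = ℤ∣.∣m⇒∣m*n _ p∣a
      ... | no  p∤a = ℤ∣.∣n⇒∣m*n (+ a) (p∤∧p∣*⇒p∣ p∤a^d-1 (subst (_ ∣ℤ_) (sym (geometric-sum k ((+ a) ^ d))) (∣diff a^dk≈1)))
        where
        p∤a^d-1 : p∤ (+ a) ^ d - + 1
        p∤a^d-1 p∣a^d-1 = proj₂ (∈-filter⁻ nonroot? {xs = upTo p} a∈) (≈⇒≡[mod] {p} {(+ a) ^ d} {+ 1} (mk≈ p∣a^d-1))
        a^dk≈1 : ((+ a) ^ d) ^ suc k ≈[ p ] + 1
        a^dk≈1 = subst (_≈[ p ] + 1) (trans (cong ((+ a) ^_) (sym d[k+1]≡p′)) (sym (ℤₚ.^-*-assoc (+ a) d (suc k))))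
                       (fermat-unit (+ a) p∤a)
      nonroots-≤ : length nonroots ℕ.≤ suc (d ℕ.* k)
      nonroots-≤ = begin
          length nonroots             ≡⟨ sym (Listₚ.length-map +_ nonroots) ⟩
          length (map +_ nonroots)    ≤⟨ lagrange cs (map +_ nonroots)
                                           (residues-incongruent nonroots (Uniqueₚ.filter⁺ nonroot? (Uniqueₚ.upTo⁺ p))
                                              (All.tabulate (λ a∈ → ∈-upTo⁻ (proj₁ (∈-filter⁻ nonroot? {xs = upTo p} a∈)))))
                                           (Allₚ.map⁺ (All.tabulate (λ {a} a∈ → subst (_ ∣ℤ_) (sym (eval-cs (+ a))) (root a∈)))) ⟩
          length cs                   ≡⟨ cong suc (length-sparse-geometric d′ k) ⟩
          suc (d ℕ.* k)               ∎

    roots-of-unity-∣p-1 : ∀ d → d ℕ∣.∣ p′ → length (roots-of-unity p d) ≡ d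
    roots-of-unity-∣p-1 zero      (ℕ∣.divides k p′≡k*0) = ⊥-elim (ℕₚ.<⇒≢ 1<p (cong suc (sym (trans p′≡k*0 (ℕₚ.*-zeroʳ k)))))
    roots-of-unity-∣p-1 (suc d′)  (ℕ∣.divides zero p′≡0) = ⊥-elim (ℕₚ.<⇒≢ 1<p (cong suc (sym p′≡0)))
    roots-of-unity-∣p-1 (suc d′)  (ℕ∣.divides (suc k) p′≡[k+1]d) =
      ℕₚ.≤-antisym (roots-of-unity-≤ d′) (roots-of-unity-≥ d′ k (trans (ℕₚ.*-comm (suc d′) (suc k)) (sym p′≡[k+1]d)))

    root-of-unity⇒p∤ : ∀ n z → z ^ suc n ≈[ p ] + 1 → p∤ z
    root-of-unity⇒p∤ n z z^N≈1 p∣z = p∤1 (∣-resp-≈ z^N≈1 (ℤ∣.∣m⇒∣m*n (z ^ n) p∣z))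

    isRootOfUnity-gcd : ∀ n → IsRootOfUnity p (suc n) ≐ IsRootOfUnity p (gcd (suc n) p′)
    isRootOfUnity-gcd n = to , from
      where
      N = suc n
      g = gcd N p′
      to : ∀ {a} → IsRootOfUnity p N a → IsRootOfUnity p g a
      to {a} root = ≈⇒≡[mod] (bezout (Bézout.identity (gcd-GCD N p′)))
        where
        a^N≈1 = ≡[mod]⇒≈ root
        a^p′≈1 = fermat-unit (+ a) (root-of-unity⇒p∤ n (+ a) a^N≈1)
        bezout : Bézout.Identity g N p′ → (+ a) ^ g ≈[ p ] + 1
        bezout (Bézout.+- x y g+yp′≡xN) =
          ^-≈1-cancel g (p′ ℕ.* y) (^-≈1-multiple p′ y a^p′≈1)
            (subst (λ e → (+ a) ^ e ≈[ p ] + 1) (sym (trans (cong (g ℕ.+_) (ℕₚ.*-comm p′ y)) (trans g+yp′≡xN (ℕₚ.*-comm x N))))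
                   (^-≈1-multiple N x a^N≈1))
        bezout (Bézout.-+ x y g+xN≡yp′) =
          ^-≈1-cancel g (N ℕ.* x) (^-≈1-multiple N x a^N≈1)
            (subst (λ e → (+ a) ^ e ≈[ p ] + 1) (sym (trans (cong (g ℕ.+_) (ℕₚ.*-comm N x)) (trans g+xN≡yp′ (ℕₚ.*-comm y p′))))
                   (^-≈1-multiple p′ y a^p′≈1))
      from : ∀ {a} → IsRootOfUnity p g a → IsRootOfUnity p N a
      from {a} root with gcd[m,n]∣m N p′
      ... | ℕ∣.divides q N≡qg = ≈⇒≡[mod] (subst (λ e → (+ a) ^ e ≈[ p ] + 1) (sym (trans N≡qg (ℕₚ.*-comm q g)))
                                             (^-≈1-multiple g q (≡[mod]⇒≈ root)))

    roots-of-unity-mod-p : ∀ n → length (roots-of-unity p (suc n)) ≡ gcd (suc n) p′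
    roots-of-unity-mod-p n = trans
      (cong length (Listₚ.filter-≐ (isRootOfUnity? p (suc n)) (isRootOfUnity? p g) (isRootOfUnity-gcd n) (upTo p)))
      (roots-of-unity-∣p-1 g (gcd[m,n]∣n (suc n) p′))
      where g = gcd (suc n) p′

    roots-of-unity-≈[p]⇒≡ : ∀ r n → p∤ + suc n → ∀ {a b} → a ∈ roots-of-unity (p ℕ.^ suc r) (suc n)
                          → b ∈ roots-of-unity (p ℕ.^ suc r) (suc n) → + a ≈[ p ] + b → a ≡ b
    roots-of-unity-≈[p]⇒≡ r n p∤N {a} {b} a∈ b∈ a≈b with ∈-roots-of-unity⁻ (p ℕ.^ suc r) (suc n) a∈ | ∈-roots-of-unity⁻ (p ℕ.^ suc r) (suc n) b∈
    ... | a<q , a^N≈1 | b<q , b^N≈1 = <∧≈⇒≡ a<q b<q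
      (hensel-unique n (+ a) (+ b) p∤N (root-of-unity⇒p∤ n (+ b) (≈-weaken (p∣p^suc r) b^N≈1)) a≈b r (≈-trans a^N≈1 (≈-sym b^N≈1)))

    roots-of-unity-distinct : ∀ r n → p∤ + suc n → ∀ {a b} → a ∈ roots-of-unity (p ℕ.^ suc r) (suc n)
                            → b ∈ roots-of-unity (p ℕ.^ suc r) (suc n) → a ≢ b → p∤ + a - + b
    roots-of-unity-distinct r n p∤N a∈ b∈ a≢b p∣a-b = a≢b (roots-of-unity-≈[p]⇒≡ r n p∤N a∈ b∈ (mk≈ p∣a-b))

    roots-of-unity-lift : ∀ r n → p∤ + suc n → length (roots-of-unity (p ℕ.^ suc r) (suc n)) ≡ length (roots-of-unity p (suc n))
    roots-of-unity-lift r n p∤N = begin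
        length Rq                ≡⟨ sym (Listₚ.length-map reduce Rq) ⟩
        length (map reduce Rq)   ≡⟨ ↭-length (∼bag⇒↭ (unique∧set⇒bag reduce-unique (roots-of-unity-unique p N) same-elements)) ⟩
        length Rp                ∎
      where
      open ≡-Reasoning
      N = suc n
      q = p ℕ.^ suc r
      instance
        q≢0 : NonZero q
        q≢0 = ℕₚ.m^n≢0 p (suc r)
      Rq = roots-of-unity q N
      Rp = roots-of-unity p N
      reduce : ℕ → ℕ
      reduce a = a ℕ.% p
      reduce-≈ : ∀ a → + reduce a ≈[ p ] + a
      reduce-≈ a = %ℕ-≈ (+ a) p
      q⇒p : ∀ {a b} → a ≈[ q ] b → a ≈[ p ] b
      q⇒p = ≈-weaken (p∣p^suc r)
      root-mod-q : ∀ {a} → a ∈ Rq → (+ a) ^ N ≈[ q ] + 1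
      root-mod-q a∈ = proj₂ (∈-roots-of-unity⁻ q N a∈)
      reduce-injective : ∀ {a b} → a ∈ Rq → b ∈ Rq → reduce a ≡ reduce b → a ≡ b
      reduce-injective {a} {b} a∈ b∈ ra≡rb = roots-of-unity-≈[p]⇒≡ r n p∤N a∈ b∈
        (≈-trans (≈-sym (reduce-≈ a)) (≈-trans (≈-reflexive (cong +_ ra≡rb)) (reduce-≈ b)))
      reduce-unique : Unique (map reduce Rq)
      reduce-unique = map-injectiveOn⁺ reduce reduce-injective (roots-of-unity-unique q N)
      reduce-root : ∀ {a} → a ∈ Rq → reduce a ∈ Rp
      reduce-root {a} a∈ = ∈-roots-of-unity⁺ p N (ℕ%.m%n<n a p) (≈-trans (^-cong N (reduce-≈ a)) (q⇒p (root-mod-q a∈)))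
      lift-root : ∀ {c} → c ∈ Rp → c ∈ map reduce Rq
      lift-root {c} c∈ = lift (hensel n (+ 1) (+ c) p∤N (root-of-unity⇒p∤ n (+ c) c^N≈1) c^N≈1 r)
        where
        c^N≈1 = proj₂ (∈-roots-of-unity⁻ p N c∈)
        lift : (∃ λ a′ → a′ ≈[ p ] + c × a′ ^ N ≈[ q ] + 1) → c ∈ map reduce Rq
        lift (a′ , a′≈c , a′^N≈1) = subst (_∈ map reduce Rq) reduce-a≡c (∈-map⁺ reduce a∈Rq)
          where
          a = a′ %ℕ q
          a≈a′ : + a ≈[ q ] a′
          a≈a′ = %ℕ-≈ a′ q
          a∈Rq : a ∈ Rq
          a∈Rq = ∈-roots-of-unity⁺ q N (ℤ/.n%ℕd<d a′ q) (≈-trans (^-cong N a≈a′) a′^N≈1)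
          reduce-a≡c : reduce a ≡ c
          reduce-a≡c = <∧≈⇒≡ (ℕ%.m%n<n a p) (proj₁ (∈-roots-of-unity⁻ p N c∈))
                         (≈-trans (reduce-≈ a) (≈-trans (q⇒p a≈a′) a′≈c))
      same-elements : map reduce Rq ∼[ set ] Rp
      same-elements = mk⇔ reduced-root lift-root
        where
        reduced-root : ∀ {c} → c ∈ map reduce Rq → c ∈ Rp
        reduced-root c∈ with ∈-map⁻ reduce c∈
        ... | a , a∈ , refl = reduce-root a∈

    -- Monic quadratics modulo p^(r+1)

    cancel-unit : ∀ r z x → p∤ z → z * x ≈[ p ℕ.^ suc r ] + 0 → x ≈[ p ℕ.^ suc r ] + 0
    cancel-unit r z x p∤z zx≈0 = cancel (inverse-mod-p^ z p∤z r)
      where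
      open ≈-Reasoning (p ℕ.^ suc r)
      regroup : ∀ z v x → z * v * x ≡ v * (z * x)
      regroup = solve-∀
      cancel : (∃ λ v → z * v ≈[ p ℕ.^ suc r ] + 1) → x ≈[ p ℕ.^ suc r ] + 0
      cancel (v , zv≈1) = begin
          x               ≡⟨ sym (ℤₚ.*-identityˡ x) ⟩
          + 1 * x         ≈⟨ *-cong (≈-sym zv≈1) ≈-refl ⟩
          z * v * x       ≡⟨ regroup z v x ⟩
          v * (z * x)     ≈⟨ *-congˡ v zx≈0 ⟩
          v * + 0         ≡⟨ ℤₚ.*-zeroʳ v ⟩
          + 0             ∎

    -- Completing the square: the roots are (- b ± s) / 2, with s a square root of the discriminant lifted by Hensel.
    split-quadratic : p∤ + 2 → ∀ r b c → LegendreIsOne (disc b c) p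
                    → ∃ λ α → ∃ λ β → b ≈[ p ℕ.^ suc r ] - (α + β) × c ≈[ p ℕ.^ suc r ] α * β × p∤ α - β
    split-quadratic p∤2 r b c (p∤Δ , x₀ , x₀²≡Δ) =
      roots (hensel 1 Δ x₀ p∤2 p∤x₀ (≈-trans (≈-reflexive (square x₀)) x₀²≈Δ) r) (inverse-mod-p^ (+ 2) p∤2 r)
      where
      q = p ℕ.^ suc r
      Δ = disc b c
      x₀²≈Δ : x₀ * x₀ ≈[ p ] Δ
      x₀²≈Δ = ≡[mod]⇒≈ x₀²≡Δ
      square : ∀ x → x ^ 2 ≡ x * x
      square x = cong (x *_) (ℤₚ.*-identityʳ x)
      p∤x₀ : p∤ x₀
      p∤x₀ p∣x₀ = p∤Δ (∣⇒∣ᵤ (∣-resp-≈ x₀²≈Δ (ℤ∣.∣m⇒∣m*n x₀ p∣x₀)))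
      roots : (∃ λ s → s ≈[ p ] x₀ × s ^ 2 ≈[ q ] Δ) → (∃ λ i → + 2 * i ≈[ q ] + 1)
            → ∃ λ α → ∃ λ β → b ≈[ q ] - (α + β) × c ≈[ q ] α * β × p∤ α - β
      roots (s , s≈x₀ , s^2≈Δ) (i , 2i≈1) = α , β , b≈ , c≈ , p∤α-β
        where
        open ≈-Reasoning q
        α = (- b + s) * i
        β = (- b - s) * i
        b≈ : b ≈[ q ] - (α + β)
        b≈ = ≈-sym (begin
            - (α + β)           ≡⟨ sum b s i ⟩
            b * (+ 2 * i)       ≈⟨ *-congˡ b 2i≈1 ⟩
            b * + 1             ≡⟨ ℤₚ.*-identityʳ b ⟩
            b                   ∎)
          where
          sum : ∀ b s i → - ((- b + s) * i + (- b - s) * i) ≡ b * (+ 2 * i)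
          sum = solve-∀
        c≈ : c ≈[ q ] α * β
        c≈ = ≈-sym (begin
            α * β                                   ≡⟨ product b s i ⟩
            (b * b - s ^ 2) * (i * i)               ≈⟨ *-cong (-cong (≈-refl {a = b * b}) s^2≈Δ) (≈-refl {a = i * i}) ⟩
            (b * b - Δ) * (i * i)                   ≡⟨ product′ b c i ⟩
            c * ((+ 2 * i) * (+ 2 * i))             ≈⟨ *-congˡ c (*-cong 2i≈1 2i≈1) ⟩
            c * (+ 1 * + 1)                         ≡⟨ ℤₚ.*-identityʳ c ⟩
            c                                       ∎)
          where
          product : ∀ b s i → (- b + s) * i * ((- b - s) * i) ≡ (b * b - s * (s * + 1)) * (i * i)
          product = solve-∀
          product′ : ∀ b c i → (b * b - (b * b - + 4 * c)) * (i * i) ≡ c * ((+ 2 * i) * (+ 2 * i))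
          product′ = solve-∀
        α-β≈s : α - β ≈[ q ] s
        α-β≈s = begin
            α - β               ≡⟨ difference b s i ⟩
            s * (+ 2 * i)       ≈⟨ *-congˡ s 2i≈1 ⟩
            s * + 1             ≡⟨ ℤₚ.*-identityʳ s ⟩
            s                   ∎
          where
          difference : ∀ b s i → (- b + s) * i - (- b - s) * i ≡ s * (+ 2 * i)
          difference = solve-∀
        p∤α-β : p∤ α - β
        p∤α-β = p∤-resp-≈ (≈-trans (≈-weaken (p∣p^suc r) α-β≈s) s≈x₀) p∤x₀

    module Quadratics (r M : ℕ) (p∤N : p∤ + suc M) where

      q : ℕ
      q = p ℕ.^ suc r

      N : ℕ
      N = suc M

      instance
        q≢0 : NonZero q
        q≢0 = ℕₚ.m^n≢0 p (suc r)

      R : List ℕ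
      R = roots-of-unity q N

      encode : ℕ × ℕ → Fin q × Fin q
      encode (a , b) = residue q (- (+ a + + b)) , residue q (+ a * + b)

      quadratics : List (Fin q × Fin q)
      quadratics = map encode (pairs R)

      q⇒p : ∀ {x y} → x ≈[ q ] y → x ≈[ p ] y
      q⇒p = ≈-weaken (p∣p^suc r)

      ∈R⇒p∤ : ∀ {a} → a ∈ R → p∤ + a
      ∈R⇒p∤ a∈ = root-of-unity⇒p∤ M _ (q⇒p (proj₂ (∈-roots-of-unity⁻ q N a∈)))

      encode-sum : ∀ a b a′ b′ → encode (a , b) ≡ encode (a′ , b′) → + a + + b ≈[ q ] + a′ + + b′
      encode-sum a b a′ b′ eq =
        ≈-trans (≈-reflexive (sym (ℤₚ.neg-involutive _)))
          (≈-trans (-‿cong (residue-injective q (cong proj₁ eq))) (≈-reflexive (ℤₚ.neg-involutive _)))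

      encode-product : ∀ a b a′ b′ → encode (a , b) ≡ encode (a′ , b′) → + a * + b ≈[ q ] + a′ * + b′
      encode-product a b a′ b′ eq = residue-injective q (cong proj₂ eq)

      ∈R⇒<q : ∀ {a} → a ∈ R → a ℕ.< q
      ∈R⇒<q a∈ = proj₁ (∈-roots-of-unity⁻ q N a∈)

      encode-injective : ∀ {u v} → u ∈ pairs R → v ∈ pairs R → encode u ≡ encode v → u ≡ v
      encode-injective {a , b} {a′ , b′} u∈ v∈ eq with ∈-pairs⁻ R u∈ | ∈-pairs⁻ R v∈ | a ℕₚ.≟ a′ | a ℕₚ.≟ b′
      ... | _ , b∈ | _ , b′∈ | yes refl | _ =
        cong (a ,_) (<∧≈⇒≡ (∈R⇒<q b∈) (∈R⇒<q b′∈) (+-cancelˡ-≈ (+ a) (encode-sum a b a′ b′ eq)))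
      ... | _ , b∈ | a′∈ , _ | no _ | yes refl =
        ⊥-elim (∈-pairs-asym R (roots-of-unity-unique q N) u∈ (subst (λ x → (x , a) ∈ pairs R) (sym b≡a′) v∈))
        where
        b≡a′ : b ≡ a′
        b≡a′ = <∧≈⇒≡ (∈R⇒<q b∈) (∈R⇒<q a′∈)
                 (+-cancelˡ-≈ (+ a) (≈-trans (encode-sum a b a′ b′ eq) (≈-reflexive (ℤₚ.+-comm (+ a′) (+ a)))))
      ... | a∈ , _ | a′∈ , b′∈ | no a≢a′ | no a≢b′ =
        ⊥-elim (p∤-* (distinct a∈ a′∈ a≢a′) (distinct a∈ b′∈ a≢b′)
                     (≈0⇒∣ (q⇒p (same-sum-product (+ a) (+ b) (+ a′) (+ b′) (encode-sum a b a′ b′ eq) (encode-product a b a′ b′ eq)))))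
        where distinct = roots-of-unity-distinct r M p∤N

      encode-conditions : ∀ {a b} → a ∈ R → b ∈ R → a ≢ b
                        → Conditions (suc N) p q (+ toℕ (proj₁ (encode (a , b)))) (+ toℕ (proj₂ (encode (a , b))))
      encode-conditions {a} {b} a∈ b∈ a≢b = legendre , unit , p∤c , gcmd
        where
        α = + a
        β = + b
        b̃ = + toℕ (proj₁ (encode (a , b)))
        c̃ = + toℕ (proj₂ (encode (a , b)))
        b≈ : b̃ ≈[ q ] - (α + β)
        b≈ = toℕ-residue q (- (α + β))
        c≈ : c̃ ≈[ q ] α * β
        c≈ = toℕ-residue q (α * β)
        Δ≈ : disc b̃ c̃ ≈[ q ] (α - β) * (α - β)
        Δ≈ = disc-≈ α β b≈ c≈
        p∤α-β : p∤ α - β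
        p∤α-β = roots-of-unity-distinct r M p∤N a∈ b∈ a≢b
        legendre : LegendreIsOne (disc b̃ c̃) p
        legendre = (λ p∣Δ → p∤-* p∤α-β p∤α-β (∣-resp-≈ (q⇒p Δ≈) (∣ᵤ⇒∣ p∣Δ))) , α - β , ≈⇒≡[mod] (≈-sym (q⇒p Δ≈))
        inverse-α-β = inverse-mod-p^ (α - β) p∤α-β r
        y = proj₁ inverse-α-β
        [α-β]y≈1 : (α - β) * y ≈[ q ] + 1
        [α-β]y≈1 = proj₂ inverse-α-β
        regroup : ∀ d y → d * d * (y * y) ≡ (d * y) * (d * y)
        regroup = solve-∀
        unit : IsUnitMod (disc b̃ c̃) q
        unit = y * y , ≈⇒≡[mod] (begin
            disc b̃ c̃ * (y * y)               ≈⟨ *-cong Δ≈ (≈-refl {a = y * y}) ⟩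
            (α - β) * (α - β) * (y * y)       ≡⟨ regroup (α - β) y ⟩
            (α - β) * y * ((α - β) * y)       ≈⟨ *-cong [α-β]y≈1 [α-β]y≈1 ⟩
            + 1                               ∎)
          where open ≈-Reasoning q
        p∤c : ¬ (+ p ℤD.∣ eval (quad b̃ c̃) (+ 0))
        p∤c p∣c₀ = p∤-* (∈R⇒p∤ a∈) (∈R⇒p∤ b∈) (∣-resp-≈ (q⇒p c≈) (subst (+ p ∣ℤ_) (eval-quad-0 b̃ c̃) (∣ᵤ⇒∣ p∣c₀)))
        gcmd : GcmdIs q (XnMinusX (suc N)) (quad b̃ c̃) (quad b̃ c̃)
        gcmd = gcmd-roots-of-unity α β y M b̃ c̃ (≈-trans (≈-reflexive (ℤₚ.*-comm y (α - β))) [α-β]y≈1)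
                 (proj₂ (∈-roots-of-unity⁻ q N a∈)) (proj₂ (∈-roots-of-unity⁻ q N b∈)) b≈ c≈

      root-of-quadratic : ∀ {b c} γ → GcmdIs q (XnMinusX (suc N)) (quad b c) (quad b c) → p∤ γ
                        → eval (quad b c) γ ≈[ q ] + 0 → γ %ℕ q ∈ R
      root-of-quadratic {b} {c} γ gcmd p∤γ fγ≈0 = ∈-roots-of-unity⁺ q N (ℤ/.n%ℕd<d γ q)
        (≈-trans (^-cong N (%ℕ-≈ γ q)) (mk≈ (≈0⇒∣ γ^N-1≈0)))
        where
        factor : ∀ γ g → γ * g - γ ≡ γ * (g - + 1)
        factor = solve-∀
        γ^N-1≈0 : γ ^ N - + 1 ≈[ q ] + 0
        γ^N-1≈0 = cancel-unit r γ (γ ^ N - + 1) p∤γ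
                    (≈-trans (≈-reflexive (sym (factor γ (γ ^ N)))) (gcmd⇒root (suc N) (quad b c) γ gcmd fγ≈0))

      conditions⇒∈ : p∤ + 2 → ∀ b̂ ĉ → Conditions (suc N) p q (+ toℕ b̂) (+ toℕ ĉ) → (b̂ , ĉ) ∈ quadratics
      conditions⇒∈ p∤2 b̂ ĉ (legendre , _ , p∤c₀ , gcmd) = from-roots (split-quadratic p∤2 r b̃ c̃ legendre)
        where
        b̃ = + toℕ b̂
        c̃ = + toℕ ĉ
        p∤c : p∤ c̃
        p∤c p∣c = p∤c₀ (∣⇒∣ᵤ (subst (+ p ∣ℤ_) (sym (eval-quad-0 b̃ c̃)) p∣c))
        from-roots : (∃ λ α → ∃ λ β → b̃ ≈[ q ] - (α + β) × c̃ ≈[ q ] α * β × p∤ α - β) → (b̂ , ĉ) ∈ quadratics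
        from-roots (α , β , b≈ , c≈ , p∤α-β) =
          [ encoded a b (+-cong a≈α b≈β) (*-cong a≈α b≈β)
          , encoded b a (≈-trans (+-cong b≈β a≈α) (≈-reflexive (ℤₚ.+-comm β α))) (≈-trans (*-cong b≈β a≈α) (≈-reflexive (ℤₚ.*-comm β α)))
          ]′ (∈-pairs⁺ R a∈ b∈ a≢b)
          where
          a = α %ℕ q
          b = β %ℕ q
          a≈α : + a ≈[ q ] α
          a≈α = %ℕ-≈ α q
          b≈β : + b ≈[ q ] β
          b≈β = %ℕ-≈ β q
          p∤α : p∤ α
          p∤α p∣α = p∤c (∣-resp-≈ (q⇒p (≈-sym c≈)) (ℤ∣.∣m⇒∣m*n β p∣α))
          p∤β : p∤ β
          p∤β p∣β = p∤c (∣-resp-≈ (q⇒p (≈-sym c≈)) (ℤ∣.∣n⇒∣m*n α p∣β))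
          vieta : ∀ x y → x * y + - (x + y) * x + x * x ≡ + 0
          vieta = solve-∀
          is-root : ∀ x y → b̃ ≈[ q ] - (x + y) → c̃ ≈[ q ] x * y → eval (quad b̃ c̃) x ≈[ q ] + 0
          is-root x y b≈′ c≈′ = ≈-trans (≈-reflexive (eval-quad b̃ c̃ x))
            (≈-trans (+-cong (+-cong c≈′ (*-cong b≈′ (≈-refl {a = x}))) (≈-refl {a = x * x})) (≈-reflexive (vieta x y)))
          a∈ : a ∈ R
          a∈ = root-of-quadratic α gcmd p∤α (is-root α β b≈ c≈)
          b∈ : b ∈ R
          b∈ = root-of-quadratic β gcmd p∤β (is-root β α (≈-trans b≈ (≈-reflexive (cong -_ (ℤₚ.+-comm α β))))
                                                        (≈-trans c≈ (≈-reflexive (ℤₚ.*-comm α β))))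
          a≢b : a ≢ b
          a≢b a≡b = p∤α-β (∣diff (q⇒p (≈-trans (≈-sym a≈α) (≈-trans (≈-reflexive (cong +_ a≡b)) b≈β))))
          encoded : ∀ x y → + x + + y ≈[ q ] α + β → + x * + y ≈[ q ] α * β → (x , y) ∈ pairs R → (b̂ , ĉ) ∈ quadratics
          encoded x y sum≈ product≈ xy∈ = subst (_∈ quadratics) (cong₂ _,_
            (trans (residue-cong q (≈-trans (-‿cong sum≈) (≈-sym b≈))) (residue-toℕ q b̂))
            (trans (residue-cong q (≈-trans product≈ (≈-sym c≈))) (residue-toℕ q ĉ)))
            (∈-map⁺ encode xy∈)

      quadratics-unique : Unique quadratics
      quadratics-unique = map-injectiveOn⁺ encode encode-injective (pairs-unique R (roots-of-unity-unique q N))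

      ∈-quadratics⇔conditions : p∤ + 2 → ∀ bc → bc ∈ quadratics ⇔ Conditions (suc N) p q (+ toℕ (proj₁ bc)) (+ toℕ (proj₂ bc))
      ∈-quadratics⇔conditions p∤2 (b̂ , ĉ) = mk⇔ to (conditions⇒∈ p∤2 b̂ ĉ)
        where
        to : (b̂ , ĉ) ∈ quadratics → Conditions (suc N) p q (+ toℕ b̂) (+ toℕ ĉ)
        to bc∈ with ∈-map⁻ encode bc∈
        ... | (a , b) , ab∈ , refl =
          encode-conditions (proj₁ (∈-pairs⁻ R ab∈)) (proj₂ (∈-pairs⁻ R ab∈)) (∈-pairs⇒≢ R (roots-of-unity-unique q N) ab∈)

      length-quadratics : length quadratics ≡ L2pp (suc N) p
      length-quadratics = begin
          length quadratics                         ≡⟨ Listₚ.length-map encode (pairs R) ⟩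
          length (pairs R)                          ≡⟨ length-pairs≡half R ⟩
          (length R ℕ.* length R ℕ.∸ length R) ℕ./ 2 ≡⟨ cong (λ g → (g ℕ.* g ℕ.∸ g) ℕ./ 2) (trans (roots-of-unity-lift r M p∤N) (roots-of-unity-mod-p M)) ⟩
          L2pp (suc N) p                            ∎
        where open ≡-Reasoning

open import Defs
open import Data.Nat using (ℕ; zero; suc; _^_; _≤_)
import Data.Nat.Properties as ℕₚ
open import Data.Nat.Divisibility as ℕ∣ using (_∣_)
open import Data.Nat.Primality using (Prime)
open import Data.Fin using (Fin; toℕ)
open import Data.Integer using (+_)
open import Data.List using (List; length)
open import Data.List.Membership.Propositional using (_∈_)
open import Data.List.Relation.Unary.Unique.Propositional using (Unique)
open import Data.Product using (Σ; _×_; _,_; proj₁; proj₂)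
open import Data.Empty using (⊥-elim)
open import Function.Bundles using (_⇔_)
open import Relation.Nullary using (¬_)
open import Relation.Binary.PropositionalEquality using (_≡_; sym)

lemma3p2 : (n p r : ℕ) → 1 ≤ n → Prime p → ¬ (2 ∣ p) → 1 ≤ r
    → (p ^ r) ∣ n → ¬ ((p ^ suc r) ∣ n)
    → Σ (List (Fin (p ^ r) × Fin (p ^ r))) λ S
      → Unique S
      × (∀ bc → bc ∈ S ⇔
           Conditions n p (p ^ r) (+ toℕ (proj₁ bc)) (+ toℕ (proj₂ bc)))
      × length S ≡ L2pp n p
lemma3p2 (suc (suc M)) (suc p′) (suc r′) _ p-prime 2∤p _ p^r∣n _ =
  quadratics , quadratics-unique , ∈-quadratics⇔conditions (odd⇒p∤2 2∤p) , length-quadratics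
  where
  open PrimeModulus p-prime
  open Quadratics r′ M (p∣n⇒p∤n-1 M (ℕ∣.∣-trans (p∣p^suc r′) p^r∣n))
lemma3p2 _ zero _ _ p-prime _ _ _ _ = ⊥-elim (ℕₚ.n≮0 (prime⇒1< p-prime))
lemma3p2 zero (suc _) _ () _ _ _ _ _
lemma3p2 (suc _) (suc _) zero _ _ _ () _ _
lemma3p2 1 (suc p′) (suc r′) _ p-prime _ _ p^r∣1 _ =
  ⊥-elim (ℕₚ.<⇒≢ 1<p (sym (ℕ∣.∣1⇒≡1 (ℕ∣.∣-trans (p∣p^suc r′) p^r∣1))))
  where open PrimeModulus p-prime
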